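{- Let $\mathcal{C}$ be a typical circuit class, and assume that $\mathsf{P} \subseteq \mathcal{C}[n^{\log n}]$. Then for every $d \in \mathbb{N}$, any function $f:\{0,1\}^n \rightarrow \{0,1\}$ computed by (general Boolean) circuits of size $n^{\log^{d}n}$ is computed by circuits from $\mathcal{C}[n^{\log^{O(d)}n}]$.
   Context: A circuit class is typical if it is one of $\mathsf{AC}^0, \mathsf{ACC}, \mathsf{TC}^0, \mathsf{NC}^1, \mathsf{P}/\mathsf{poly}$ (non-uniform); $\mathcal{C}[s(n)]$ denotes functions computed by circuits from $\mathcal{C}$ of size $s(n)$. General Boolean circuits use $\mathsf{AND},\mathsf{OR},\mathsf{NOT}$ gates of fan-in at most two; size is the number of gates. -}

module Defs where

open import Data.Bool using (Bool; true; false; not; _∧_; _∨_; if_then_else_)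
open import Data.Nat using (ℕ; zero; suc; _+_; _*_; _^_; _≤_; _≥_; _⊔_; _≡ᵇ_; _≤ᵇ_; NonZero)
open import Data.Nat.DivMod using (_%_)
open import Data.Nat.Logarithm using (⌈log₂_⌉)
open import Data.Fin using (Fin; fromℕ)
open import Data.List using (List; []; _∷_; map; length; foldr)
open import Data.Vec using (Vec; []; _∷_; _∷ʳ_; lookup; toList)
open import Data.Product using (Σ; ∃; ∃-syntax; _×_; _,_)
open import Relation.Binary.PropositionalEquality using (_≡_)

BoolFamily : Set
BoolFamily = (n : ℕ) → Vec Bool n → Bool

Eventually : (ℕ → Set) → Set
Eventually P = ∃[ n₀ ] ((n : ℕ) → n ≥ n₀ → P n)

-- Circuits as straight-line programs.  Wires are indexed by Fin w;
-- initially w = n (the input wires); each gate creates a new wire.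

data Gate (w : ℕ) : Set where
  AND OR MAJ : List (Fin w) → Gate w
  MOD        : ℕ → List (Fin w) → Gate w
  NOT        : Fin w → Gate w

data Circuit (w : ℕ) : Set where
  output : Fin w → Circuit w
  gate   : Gate w → Circuit (suc w) → Circuit w

countTrue : List Bool → ℕ
countTrue []          = 0
countTrue (true ∷ bs) = suc (countTrue bs)
countTrue (false ∷ bs) = countTrue bs

andL orL : List Bool → Bool
andL = foldr _∧_ true
orL  = foldr _∨_ false

modTest : ℕ → ℕ → Bool
modTest zero    k = k ≡ᵇ 0
modTest (suc m) k = (k % suc m) ≡ᵇ 0

evalGate : ∀ {w} → Vec Bool w → Gate w → Bool
evalGate env (AND is)  = andL (map (lookup env) is)
evalGate env (OR is)   = orL (map (lookup env) is)
evalGate env (MAJ is)  = length is ≤ᵇ (2 * countTrue (map (lookup env) is))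
evalGate env (MOD m is) = modTest m (countTrue (map (lookup env) is))
evalGate env (NOT i)   = not (lookup env i)

eval : ∀ {w} → Circuit w → Vec Bool w → Bool
eval (output i) env = lookup env i
eval (gate g c) env = eval c (env ∷ʳ evalGate env g)

size : ∀ {w} → Circuit w → ℕ
size (output _) = 0
size (gate _ c) = suc (size c)

maxL : List ℕ → ℕ
maxL = foldr _⊔_ 0

gateDepth : ∀ {w} → Vec ℕ w → Gate w → ℕ
gateDepth ds (AND is)   = suc (maxL (map (lookup ds) is))
gateDepth ds (OR is)    = suc (maxL (map (lookup ds) is))
gateDepth ds (MAJ is)   = suc (maxL (map (lookup ds) is))
gateDepth ds (MOD _ is) = suc (maxL (map (lookup ds) is))
gateDepth ds (NOT i)    = suc (lookup ds i)

depthFrom : ∀ {w} → Vec ℕ w → Circuit w → ℕ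
depthFrom ds (output i) = lookup ds i
depthFrom ds (gate g c) = depthFrom (ds ∷ʳ gateDepth ds g) c

zeros : (n : ℕ) → Vec ℕ n
zeros zero    = []
zeros (suc n) = 0 ∷ zeros n

depth : ∀ {n} → Circuit n → ℕ
depth {n} = depthFrom (zeros n)

AllGates : (∀ {w} → Gate w → Set) → ∀ {w} → Circuit w → Set
AllGates P (output _) = Data.Unit.⊤ where import Data.Unit
AllGates P (gate g c) = P g × AllGates P c

data ⊥' : Set where
data ⊤' : Set where tt : ⊤'

FanIn2 : ∀ {w} → Gate w → Set
FanIn2 (AND is)   = length is ≤ 2
FanIn2 (OR is)    = length is ≤ 2
FanIn2 (MAJ _)    = ⊥'
FanIn2 (MOD _ _)  = ⊥'
FanIn2 (NOT _)    = ⊤'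

ACGate : ∀ {w} → Gate w → Set
ACGate (AND _)   = ⊤'
ACGate (OR _)    = ⊤'
ACGate (MAJ _)   = ⊥'
ACGate (MOD _ _) = ⊥'
ACGate (NOT _)   = ⊤'

ACCGate : ℕ → ∀ {w} → Gate w → Set
ACCGate m (AND _)    = ⊤'
ACCGate m (OR _)     = ⊤'
ACCGate m (MAJ _)    = ⊥'
ACCGate m (MOD m' _) = m' ≡ m
ACCGate m (NOT _)    = ⊤'

TCGate : ∀ {w} → Gate w → Set
TCGate (AND _)   = ⊤'
TCGate (OR _)    = ⊤'
TCGate (MAJ _)   = ⊤'
TCGate (MOD _ _) = ⊥'
TCGate (NOT _)   = ⊤'

Computes : ∀ {n} → Circuit n → (Vec Bool n → Bool) → Set
Computes c g = ∀ x → eval c x ≡ g x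

InSIZE : (ℕ → ℕ) → BoolFamily → Set
InSIZE s f = Eventually λ n →
  Σ (Circuit n) λ c → AllGates FanIn2 c × size c ≤ s n × Computes c (f n)

data TypicalClass : Set where
  AC0 ACC TC0 NC1 PPoly : TypicalClass

SizeDepth : (∀ {w} → Gate w → Set) → (ℕ → ℕ) → (ℕ → ℕ) → BoolFamily → Set
SizeDepth P s D f = Eventually λ n →
  Σ (Circuit n) λ c → AllGates P c × size c ≤ s n × depth c ≤ D n × Computes c (f n)

InClass : TypicalClass → (ℕ → ℕ) → BoolFamily → Set
InClass AC0   s f = ∃[ D ] SizeDepth ACGate s (λ _ → D) f
InClass ACC   s f = ∃[ m ] (2 ≤ m × ∃[ D ] SizeDepth (ACCGate m) s (λ _ → D) f)
InClass TC0   s f = ∃[ D ] SizeDepth TCGate s (λ _ → D) f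
InClass NC1   s f = ∃[ k ] SizeDepth FanIn2 s (λ n → k * ⌈log₂ (s n) ⌉ + k) f
InClass PPoly s f = InSIZE s f

data Sym : Set where
  blank b0 b1 : Sym

data Dir : Set where
  L R S : Dir

record TM : Set where
  field
    Q      : ℕ
    start  : Fin Q
    δ      : Fin Q → Sym → Fin Q × Sym × Dir
    halts  : Fin Q → Bool
    accept : Fin Q → Bool

-- configuration: state, tape left of head (nearest first), head symbol, tape right of head
record Config (M : TM) : Set where
  constructor cfg
  field
    state : Fin (TM.Q M)
    left  : List Sym
    head  : Sym
    right : List Sym

move : Dir → List Sym → Sym → List Sym → List Sym × Sym × List Sym
move L []      a rs = [] , blank , a ∷ rs
move L (l ∷ ls) a rs = ls , l , a ∷ rs
move R ls a []       = a ∷ ls , blank , []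
move R ls a (r ∷ rs) = a ∷ ls , r , rs
move S ls a rs = ls , a , rs

step : (M : TM) → Config M → Config M
step M (cfg q ls a rs) with TM.halts M q
... | true  = cfg q ls a rs
... | false with TM.δ M q a
...   | q' , a' , d with move d ls a' rs
...     | ls' , h , rs' = cfg q' ls' h rs'

run : (M : TM) → ℕ → Config M → Config M
run M zero    c = c
run M (suc t) c = run M t (step M c)

bitSym : Bool → Sym
bitSym false = b0
bitSym true  = b1

initial : (M : TM) → List Bool → Config M
initial M []       = cfg (TM.start M) [] blank []
initial M (b ∷ bs) = cfg (TM.start M) [] (bitSym b) (map bitSym bs)

DecidesIn : (M : TM) → (ℕ → ℕ) → BoolFamily → Set
DecidesIn M T f = ∀ n (x : Vec Bool n) → ∃[ t ] (t ≤ T n ×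
  (TM.halts M (Config.state (run M t (initial M (toList x)))) ≡ true ×
   TM.accept M (Config.state (run M t (initial M (toList x)))) ≡ f n x))

InP : BoolFamily → Set
InP f = ∃[ M ] ∃[ k ] DecidesIn M (λ n → n ^ k + k) f

quasiPoly : ℕ → ℕ → ℕ
quasiPoly d n = n ^ (⌈log₂ n ⌉ ^ d)

module Submission where

-- Padding through one explicit language in P, the circuit value problem CVP: a
-- fan-in-2 circuit of size s on n inputs is laid out on a tape of length
-- m = (n + s + 1)(8s + 16) every bit of which is a constant or an input bit, and a
-- single-tape Turing machine (the evaluator) computes the circuit's value from the
-- tape in time m^10 + 10, sweeping once per gate.  Restricting a C-circuit for CVP
-- on length m by this projection gives a C-circuit for f on length n.

open import Defs
open import Data.Nat using (ℕ; suc; _*_)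
open import Data.Product using (∃-syntax; _,_)

-- Bit vectors of length k are in bijection with Fin (2 ^ k); the evaluator uses this
-- to present its finitely many structured states as a Fin-indexed state set.
module Encoding where

  open import Data.Bool using (Bool)
  open import Data.Nat using (_^_)
  open import Data.Fin using (Fin; funToFin; finToFun)
  open import Data.Fin.Properties using (2↔Bool; finToFun-funToFin)
  open import Data.Vec using (Vec; lookup; tabulate)
  open import Data.Vec.Properties using (tabulate-cong; tabulate∘lookup)
  open import Function.Bundles using (Inverse)
  open import Relation.Binary.PropositionalEquality using (_≡_; trans; cong)

  private module Bit = Inverse 2↔Bool

  bitsToFin : ∀ {k} → Vec Bool k → Fin (2 ^ k)
  bitsToFin v = funToFin (λ i → Bit.from (lookup v i))

  finToBits : ∀ {k} → Fin (2 ^ k) → Vec Bool k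
  finToBits q = tabulate (λ i → Bit.to (finToFun q i))

  finToBits-bitsToFin : ∀ {k} (v : Vec Bool k) → finToBits (bitsToFin v) ≡ v
  finToBits-bitsToFin v = trans
    (tabulate-cong (λ i → trans (cong Bit.to (finToFun-funToFin _ i)) (Bit.strictlyInverseˡ (lookup v i))))
    (tabulate∘lookup v)

-- The sweeper: a finite-state transducer reading the tape bit by bit in blocks of
-- eight (the position in the block is `pos`).  The tape is a sequence of records, one
-- per wire; a record lists the still unconsumed gate slots of the wire and ends in a
-- block holding the wire's current value.  In each record the sweeper takes (and
-- blanks out) the first live slot, which says whether the wire is the left/right
-- input of the gate being evaluated and, for the gate's own output wire, its
-- operation; the value block is then overwritten by the operation applied to the
-- operand values collected so far.
module Sweeper where

  open import Data.Bool using (Bool; true; false; not; _∧_; _∨_; if_then_else_)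
  open import Data.Nat using (ℕ; suc; _+_; _≤_; _<_; z≤n; s≤s)
  open import Data.Nat.Properties
  open import Data.List using (List; []; _∷_; _++_; length)
  open import Data.Product using (_×_; _,_; proj₁; proj₂)
  open import Relation.Binary.PropositionalEquality

  data Pos : Set where
    p0 p1 p2 p3 p4 p5 p6 p7 : Pos

  -- seek: no slot taken yet in this record; taking: the current block is the taken
  -- slot; isSlot: the current block is a slot (not a value block); feedsL, feedsR:
  -- the wire feeds the gate's left/right input; o0 o1 o2: the operation; lv, rv: the
  -- operand values; lastValue: the last value written; consumed: some slot was taken
  -- in this sweep.
  record Sweep : Set where
    constructor mkSweep
    field
      pos : Pos
      seek taking isSlot feedsL feedsR o0 o1 o2 lv rv lastValue consumed : Bool
  open Sweep public

  -- The eight operations a slot can carry, in the form evalGate computes them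
  -- (the first one leaves the old value unchanged).
  applyOp : Bool → Bool → Bool → Bool → Bool → Bool → Bool
  applyOp false false false l r old = old
  applyOp false false true  l r old = true
  applyOp false true  false l r old = l ∧ true
  applyOp false true  true  l r old = l ∧ (r ∧ true)
  applyOp true  false false l r old = false
  applyOp true  false true  l r old = l ∨ false
  applyOp true  true  false l r old = l ∨ (r ∨ false)
  applyOp true  true  true  l r old = not l

  newValue : Sweep → Bool → Bool
  newValue σ x = applyOp (o0 σ) (o1 σ) (o2 σ) (lv σ) (rv σ) x

  sweepStep : Sweep → Bool → Bool × Sweep
  sweepStep σ x with pos σ
  ... | p0 = (if seek σ ∧ x then false else x) ,
             record σ { pos = p1 ; taking = seek σ ∧ x ; seek = seek σ ∧ not x ; consumed = consumed σ ∨ (seek σ ∧ x) }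
  ... | p1 = x , record σ { pos = p2 ; isSlot = x }
  ... | p2 = (if taking σ then false else x) , record σ { pos = p3 ; feedsL = if taking σ then x else feedsL σ }
  ... | p3 = (if taking σ then false else x) , record σ { pos = p4 ; feedsR = if taking σ then x else feedsR σ }
  ... | p4 = (if taking σ then false else x) , record σ { pos = p5 ; o0 = if taking σ then x else o0 σ }
  ... | p5 = (if taking σ then false else x) , record σ { pos = p6 ; o1 = if taking σ then x else o1 σ }
  ... | p6 = (if taking σ then false else x) , record σ { pos = p7 ; o2 = if taking σ then x else o2 σ }
  ... | p7 = if isSlot σ then (x , record σ { pos = p0 })
             else (newValue σ x , record σ { pos = p0 ; lv = if feedsL σ then newValue σ x else lv σ
                    ; rv = if feedsR σ then newValue σ x else rv σ ; lastValue = newValue σ x ; seek = true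
                    ; feedsL = false ; feedsR = false ; o0 = false ; o1 = false ; o2 = false })

  runSweep : Sweep → List Bool → List Bool × Sweep
  runSweep σ [] = [] , σ
  runSweep σ (x ∷ xs) with sweepStep σ x
  ... | y , σ' with runSweep σ' xs
  ...   | ys , σ'' = y ∷ ys , σ''

  σ₀ : Sweep
  σ₀ = mkSweep p0 true false false false false false false false false false false false

  sweepOut : Sweep → List Bool → List Bool
  sweepOut σ xs = proj₁ (runSweep σ xs)

  sweepEnd : Sweep → List Bool → Sweep
  sweepEnd σ xs = proj₂ (runSweep σ xs)

  stepOut : Sweep → Bool → Bool
  stepOut σ x = proj₁ (sweepStep σ x)

  stepNext : Sweep → Bool → Sweep
  stepNext σ x = proj₂ (sweepStep σ x)

  length-sweepOut : ∀ σ xs → length (sweepOut σ xs) ≡ length xs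
  length-sweepOut σ [] = refl
  length-sweepOut σ (x ∷ xs) = cong suc (length-sweepOut (stepNext σ x) xs)

  runSweep-++ : ∀ σ xs ys → runSweep σ (xs ++ ys) ≡ (sweepOut σ xs ++ sweepOut (sweepEnd σ xs) ys , sweepEnd (sweepEnd σ xs) ys)
  runSweep-++ σ [] ys = refl
  runSweep-++ σ (x ∷ xs) ys rewrite runSweep-++ (stepNext σ x) xs ys = refl

  runSweep-seq : ∀ σ {σ1 σ2} xs ys {o1 o2} → runSweep σ xs ≡ (o1 , σ1) → runSweep σ1 ys ≡ (o2 , σ2) → runSweep σ (xs ++ ys) ≡ (o1 ++ o2 , σ2)
  runSweep-seq σ {σ1} {σ2} xs ys e1 e2 rewrite runSweep-++ σ xs ys | e1 | e2 = refl

  -- Termination potential: the number of ones at even positions of the tape.  The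
  -- sweeper only ever clears such bits (the first bit of a slot, which marks it live,
  -- and the even bits of a taken slot), and it clears at least one in every sweep
  -- that consumes a slot.
  bitCount : Bool → ℕ
  bitCount true = 1
  bitCount false = 0

  evenOnes : Bool → List Bool → ℕ
  evenOnes b [] = 0
  evenOnes b (x ∷ xs) = bitCount (b ∧ x) + evenOnes (not b) xs

  -- Bounds the number of sweeps by the length of the tape.
  evenOnes≤length : ∀ b xs → evenOnes b xs ≤ length xs
  evenOnes≤length b [] = z≤n
  evenOnes≤length true (true ∷ xs) = s≤s (evenOnes≤length false xs)
  evenOnes≤length true (false ∷ xs) = m≤n⇒m≤1+n (evenOnes≤length false xs)
  evenOnes≤length false (x ∷ xs) = m≤n⇒m≤1+n (evenOnes≤length true xs)

  evenPhase : Pos → Bool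
  evenPhase p0 = true
  evenPhase p1 = false
  evenPhase p2 = true
  evenPhase p3 = false
  evenPhase p4 = true
  evenPhase p5 = false
  evenPhase p6 = true
  evenPhase p7 = false

  phase : Sweep → Bool
  phase σ = evenPhase (pos σ)

  phase-step : ∀ σ x → phase (stepNext σ x) ≡ not (phase σ)
  phase-step (mkSweep p0 _ _ _ _ _ _ _ _ _ _ _ _) x = refl
  phase-step (mkSweep p1 _ _ _ _ _ _ _ _ _ _ _ _) x = refl
  phase-step (mkSweep p2 _ _ _ _ _ _ _ _ _ _ _ _) x = refl
  phase-step (mkSweep p3 _ _ _ _ _ _ _ _ _ _ _ _) x = refl
  phase-step (mkSweep p4 _ _ _ _ _ _ _ _ _ _ _ _) x = refl
  phase-step (mkSweep p5 _ _ _ _ _ _ _ _ _ _ _ _) x = refl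
  phase-step (mkSweep p6 _ _ _ _ _ _ _ _ _ _ _ _) x = refl
  phase-step (mkSweep p7 _ _ true _ _ _ _ _ _ _ _ _) x = refl
  phase-step (mkSweep p7 _ _ false _ _ _ _ _ _ _ _ _) x = refl

  evenOnes-step-≤ : ∀ σ x → bitCount (phase σ ∧ stepOut σ x) ≤ bitCount (phase σ ∧ x)
  evenOnes-step-≤ (mkSweep p0 true _ _ _ _ _ _ _ _ _ _ _) true = z≤n
  evenOnes-step-≤ (mkSweep p0 true _ _ _ _ _ _ _ _ _ _ _) false = z≤n
  evenOnes-step-≤ (mkSweep p0 false _ _ _ _ _ _ _ _ _ _ _) true = s≤s z≤n
  evenOnes-step-≤ (mkSweep p0 false _ _ _ _ _ _ _ _ _ _ _) false = z≤n
  evenOnes-step-≤ (mkSweep p1 _ _ _ _ _ _ _ _ _ _ _ _) x = z≤n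
  evenOnes-step-≤ (mkSweep p2 _ true _ _ _ _ _ _ _ _ _ _) x = z≤n
  evenOnes-step-≤ (mkSweep p2 _ false _ _ _ _ _ _ _ _ _ _) x = ≤-refl
  evenOnes-step-≤ (mkSweep p3 _ _ _ _ _ _ _ _ _ _ _ _) x = z≤n
  evenOnes-step-≤ (mkSweep p4 _ true _ _ _ _ _ _ _ _ _ _) x = z≤n
  evenOnes-step-≤ (mkSweep p4 _ false _ _ _ _ _ _ _ _ _ _) x = ≤-refl
  evenOnes-step-≤ (mkSweep p5 _ _ _ _ _ _ _ _ _ _ _ _) x = z≤n
  evenOnes-step-≤ (mkSweep p6 _ true _ _ _ _ _ _ _ _ _ _) x = z≤n
  evenOnes-step-≤ (mkSweep p6 _ false _ _ _ _ _ _ _ _ _ _) x = ≤-refl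
  evenOnes-step-≤ (mkSweep p7 _ _ true _ _ _ _ _ _ _ _ _) x = z≤n
  evenOnes-step-≤ (mkSweep p7 _ _ false _ _ _ _ _ _ _ _ _) x = z≤n

  evenOnes-step-< : ∀ σ x → consumed σ ≡ false → consumed (stepNext σ x) ≡ true → bitCount (phase σ ∧ stepOut σ x) < bitCount (phase σ ∧ x)
  evenOnes-step-< (mkSweep p0 true _ _ _ _ _ _ _ _ _ _ false) true refl refl = s≤s z≤n
  evenOnes-step-< (mkSweep p0 true _ _ _ _ _ _ _ _ _ _ false) false refl ()
  evenOnes-step-< (mkSweep p0 false _ _ _ _ _ _ _ _ _ _ false) x refl ()
  evenOnes-step-< (mkSweep p1 _ _ _ _ _ _ _ _ _ _ _ _) x refl ()
  evenOnes-step-< (mkSweep p2 _ _ _ _ _ _ _ _ _ _ _ _) x refl ()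
  evenOnes-step-< (mkSweep p3 _ _ _ _ _ _ _ _ _ _ _ _) x refl ()
  evenOnes-step-< (mkSweep p4 _ _ _ _ _ _ _ _ _ _ _ _) x refl ()
  evenOnes-step-< (mkSweep p5 _ _ _ _ _ _ _ _ _ _ _ _) x refl ()
  evenOnes-step-< (mkSweep p6 _ _ _ _ _ _ _ _ _ _ _ _) x refl ()
  evenOnes-step-< (mkSweep p7 _ _ true _ _ _ _ _ _ _ _ _) x refl ()
  evenOnes-step-< (mkSweep p7 _ _ false _ _ _ _ _ _ _ _ _) x refl ()

  evenOnes-sweep-≤ : ∀ σ xs → evenOnes (phase σ) (sweepOut σ xs) ≤ evenOnes (phase σ) xs
  evenOnes-sweep-≤ σ [] = z≤n
  evenOnes-sweep-≤ σ (x ∷ xs) rewrite sym (phase-step σ x) = +-mono-≤ (evenOnes-step-≤ σ x) (evenOnes-sweep-≤ (stepNext σ x) xs)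

  evenOnes-sweep-< : ∀ σ xs → consumed σ ≡ false → consumed (sweepEnd σ xs) ≡ true → evenOnes (phase σ) (sweepOut σ xs) < evenOnes (phase σ) xs
  evenOnes-sweep-< σ [] e1 e2 with trans (sym e1) e2
  ... | ()
  evenOnes-sweep-< σ (x ∷ xs) e1 e2 rewrite sym (phase-step σ x) with consumed (stepNext σ x) in eq
  ... | true = +-mono-<-≤ (evenOnes-step-< σ x e1 eq) (evenOnes-sweep-≤ (stepNext σ x) xs)
  ... | false = +-mono-≤-< (evenOnes-step-≤ σ x) (evenOnes-sweep-< (stepNext σ x) xs eq e2)

-- Every block has eight bits.
-- A slot block is  1 1 l r a b c 0  (the wire is the left/right input of the gate if
-- l/r, and a b c is the gate's operation on its output wire and the no-op otherwise);
-- a taken slot is overwritten by the used block  0 1 0 0 0 0 0 0; a value block is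
-- 0 0 0 0 0 0 0 v.  The record of a wire is: used blocks, live slots, value block.
module TapeFormat where

  open import Data.Bool using (Bool; true; false; if_then_else_)
  open import Data.Nat using (ℕ; zero; suc)
  open import Data.List using (List; []; _∷_; _++_)
  open import Data.List.Properties using (++-assoc)
  open import Data.Product using (Σ; _,_)
  open import Relation.Binary.PropositionalEquality
  open Sweeper

  usedBlock : List Bool
  usedBlock = false ∷ true ∷ false ∷ false ∷ false ∷ false ∷ false ∷ false ∷ []

  padding₇ : List Bool
  padding₇ = false ∷ false ∷ false ∷ false ∷ false ∷ false ∷ false ∷ []

  valueBlock : Bool → List Bool
  valueBlock v = padding₇ ++ v ∷ []

  slotBlock : Bool → Bool → Bool → Bool → Bool → List Bool
  slotBlock lf rf a b c = true ∷ true ∷ lf ∷ rf ∷ a ∷ b ∷ c ∷ false ∷ []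

  pass-usedBlock : ∀ s t k pl pr a b c lv rv ls cs → runSweep (mkSweep p0 s t k pl pr a b c lv rv ls cs) usedBlock ≡ (usedBlock , mkSweep p0 s false true pl pr a b c lv rv ls cs)
  pass-usedBlock true t k pl pr a b c lv rv ls true = refl
  pass-usedBlock true t k pl pr a b c lv rv ls false = refl
  pass-usedBlock false t k pl pr a b c lv rv ls true = refl
  pass-usedBlock false t k pl pr a b c lv rv ls false = refl

  pass-takeSlot : ∀ t k lv rv ls cs lf rf a b c → runSweep (mkSweep p0 true t k false false false false false lv rv ls cs) (slotBlock lf rf a b c)
            ≡ (usedBlock , mkSweep p0 false true true lf rf a b c lv rv ls true)
  pass-takeSlot t k lv rv ls true lf rf a b c = refl
  pass-takeSlot t k lv rv ls false lf rf a b c = refl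

  pass-skipSlot : ∀ t k pl pr a b c lv rv ls cs lf rf a' b' c' → runSweep (mkSweep p0 false t k pl pr a b c lv rv ls cs) (slotBlock lf rf a' b' c')
            ≡ (slotBlock lf rf a' b' c' , mkSweep p0 false false true pl pr a b c lv rv ls cs)
  pass-skipSlot t k pl pr a b c lv rv ls true lf rf a' b' c' = refl
  pass-skipSlot t k pl pr a b c lv rv ls false lf rf a' b' c' = refl

  pass-valueBlock : ∀ s t k pl pr a b c lv rv ls cs v → runSweep (mkSweep p0 s t k pl pr a b c lv rv ls cs) (valueBlock v)
         ≡ (valueBlock (applyOp a b c lv rv v) , mkSweep p0 true false false false false false false false
              (if pl then applyOp a b c lv rv v else lv) (if pr then applyOp a b c lv rv v else rv) (applyOp a b c lv rv v) cs)
  pass-valueBlock true t k pl pr a b c lv rv ls true v = refl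
  pass-valueBlock true t k pl pr a b c lv rv ls false v = refl
  pass-valueBlock false t k pl pr a b c lv rv ls true v = refl
  pass-valueBlock false t k pl pr a b c lv rv ls false v = refl

  -- Gate operations of fan-in at most two (NONE: the slot of a wire that is not the
  -- gate's output), and their three-bit codes for applyOp.
  data Op : Set where
    NONE AND0 AND1 AND2 OR0 OR1 OR2 NOTo : Op

  opBit₀ opBit₁ opBit₂ : Op → Bool
  opBit₀ NONE = false
  opBit₀ AND0 = false
  opBit₀ AND1 = false
  opBit₀ AND2 = false
  opBit₀ OR0 = true
  opBit₀ OR1 = true
  opBit₀ OR2 = true
  opBit₀ NOTo = true
  opBit₁ NONE = false
  opBit₁ AND0 = false
  opBit₁ AND1 = true
  opBit₁ AND2 = true
  opBit₁ OR0 = false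
  opBit₁ OR1 = false
  opBit₁ OR2 = true
  opBit₁ NOTo = true
  opBit₂ NONE = false
  opBit₂ AND0 = true
  opBit₂ AND1 = false
  opBit₂ AND2 = true
  opBit₂ OR0 = false
  opBit₂ OR1 = true
  opBit₂ OR2 = false
  opBit₂ NOTo = true

  evalOp : Op → Bool → Bool → Bool → Bool
  evalOp o l r old = applyOp (opBit₀ o) (opBit₁ o) (opBit₂ o) l r old

  -- A gate's slot in a wire record: is the wire its left input, its right input, and
  -- which operation it writes to the wire.
  data Slot : Set where
    sl : Bool → Bool → Op → Slot

  slotBits : Slot → List Bool
  slotBits (sl l r o) = slotBlock l r (opBit₀ o) (opBit₁ o) (opBit₂ o)

  slotsBits : List Slot → List Bool
  slotsBits [] = []
  slotsBits (s ∷ ss) = slotBits s ++ slotsBits ss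

  -- p used blocks, left by the p gates evaluated so far.
  usedBlocks : ℕ → List Bool
  usedBlocks zero = []
  usedBlocks (suc p) = usedBlocks p ++ usedBlock

  wireRecord : ℕ → List Slot → Bool → List Bool
  wireRecord p ss v = usedBlocks p ++ (slotsBits ss ++ valueBlock v)

  pass-usedBlocks : ∀ p s k pl pr a b c lv rv ls cs → Σ Bool λ k' →
    runSweep (mkSweep p0 s false k pl pr a b c lv rv ls cs) (usedBlocks p) ≡ (usedBlocks p , mkSweep p0 s false k' pl pr a b c lv rv ls cs)
  pass-usedBlocks zero s k pl pr a b c lv rv ls cs = k , refl
  pass-usedBlocks (suc p) s k pl pr a b c lv rv ls cs with pass-usedBlocks p s k pl pr a b c lv rv ls cs
  ... | k' , e = true , runSweep-seq (mkSweep p0 s false k pl pr a b c lv rv ls cs) (usedBlocks p) usedBlock e (pass-usedBlock s false k' pl pr a b c lv rv ls cs)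

  pass-skipSlots : ∀ ss t k pl pr a b c lv rv ls cs → Σ Bool λ t' → Σ Bool λ k' →
    runSweep (mkSweep p0 false t k pl pr a b c lv rv ls cs) (slotsBits ss) ≡ (slotsBits ss , mkSweep p0 false t' k' pl pr a b c lv rv ls cs)
  pass-skipSlots [] t k pl pr a b c lv rv ls cs = t , k , refl
  pass-skipSlots (sl l r o ∷ ss) t k pl pr a b c lv rv ls cs with pass-skipSlots ss false true pl pr a b c lv rv ls cs
  ... | t' , k' , e = t' , k' , runSweep-seq (mkSweep p0 false t k pl pr a b c lv rv ls cs) (slotBlock l r (opBit₀ o) (opBit₁ o) (opBit₂ o)) (slotsBits ss) (pass-skipSlot t k pl pr a b c lv rv ls cs l r (opBit₀ o) (opBit₁ o) (opBit₂ o)) e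

  atRecord : Bool → Bool → Bool → Bool → Sweep
  atRecord lv rv ls cs = mkSweep p0 true false false false false false false false lv rv ls cs

  pass-takingRecord : ∀ p l r o ss v lv rv ls cs →
    runSweep (atRecord lv rv ls cs) (wireRecord p (sl l r o ∷ ss) v) ≡
    (wireRecord (suc p) ss (evalOp o lv rv v) ,
     atRecord (if l then evalOp o lv rv v else lv) (if r then evalOp o lv rv v else rv) (evalOp o lv rv v) true)
  pass-takingRecord p l r o ss v lv rv ls cs with pass-usedBlocks p true false false false false false false lv rv ls cs
  ... | k' , e1 with pass-skipSlots ss true true l r (opBit₀ o) (opBit₁ o) (opBit₂ o) lv rv ls true
  ...   | t' , k'' , e2 = trans main (cong (λ z → z , σEnd) eqo)
    where
    nv : Bool
    nv = evalOp o lv rv v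
    σEnd : Sweep
    σEnd = atRecord (if l then nv else lv) (if r then nv else rv) nv true
    σB : Sweep
    σB = mkSweep p0 true false k' false false false false false lv rv ls cs
    main : runSweep (atRecord lv rv ls cs) (usedBlocks p ++ ((slotBits (sl l r o) ++ slotsBits ss) ++ valueBlock v))
           ≡ (usedBlocks p ++ ((usedBlock ++ slotsBits ss) ++ valueBlock nv) , σEnd)
    main = runSweep-seq (atRecord lv rv ls cs) (usedBlocks p) ((slotBits (sl l r o) ++ slotsBits ss) ++ valueBlock v) e1
             (runSweep-seq σB (slotBits (sl l r o) ++ slotsBits ss) (valueBlock v)
                (runSweep-seq σB (slotBits (sl l r o)) (slotsBits ss) (pass-takeSlot false k' lv rv ls cs l r (opBit₀ o) (opBit₁ o) (opBit₂ o)) e2)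
                (pass-valueBlock false t' k'' l r (opBit₀ o) (opBit₁ o) (opBit₂ o) lv rv ls true v))
    eqo : usedBlocks p ++ ((usedBlock ++ slotsBits ss) ++ valueBlock nv) ≡ wireRecord (suc p) ss nv
    eqo = trans (cong (usedBlocks p ++_) (++-assoc usedBlock (slotsBits ss) (valueBlock nv))) (sym (++-assoc (usedBlocks p) usedBlock (slotsBits ss ++ valueBlock nv)))

  pass-finishedRecord : ∀ p v lv rv ls cs → runSweep (atRecord lv rv ls cs) (wireRecord p [] v) ≡ (wireRecord p [] v , atRecord lv rv v cs)
  pass-finishedRecord p v lv rv ls cs with pass-usedBlocks p true false false false false false false lv rv ls cs
  ... | k' , e1 = runSweep-seq (atRecord lv rv ls cs) (usedBlocks p) (valueBlock v) e1 (pass-valueBlock true false k' false false false false false lv rv ls cs v)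

-- The evaluator: the sweeper together with a rewinding phase.  After a sweep that
-- consumed a slot it walks back to the left end and sweeps again; otherwise it halts,
-- accepting iff the last value written (that of the circuit's output wire) is 1.
module Machine where

  open import Data.Bool using (Bool; true; false; if_then_else_)
  open import Data.Nat using (ℕ; zero; suc; pred; _+_; _∸_; _*_; _^_; _≤_; _<_; z≤n; s≤s)
  open import Data.Nat.Properties
  open import Data.Fin using (Fin)
  open import Data.Sum using (inj₁; inj₂)
  open import Data.List using (List; []; _∷_; _++_; map; length; _ʳ++_; replicate)
  open import Data.List.Properties using (map-++; ++-ʳ++; ++-assoc; length-++; ++-identityʳ)
  open import Data.Vec using (Vec; []; _∷_; toList)
  open import Data.Vec.Properties using (length-toList)
  open import Data.Product using (Σ; _×_; _,_; proj₁; proj₂)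
  open import Data.Nat.Solver using (module +-*-Solver)
  open import Relation.Binary.PropositionalEquality
  open +-*-Solver
  open Encoding
  open Sweeper

  data MState : Set where
    Sweeping : Sweep → MState
    Rewinding : MState
    Halted : Bool → MState

  posBits : Pos → Vec Bool 3
  posBits p0 = false ∷ false ∷ false ∷ []
  posBits p1 = false ∷ false ∷ true ∷ []
  posBits p2 = false ∷ true ∷ false ∷ []
  posBits p3 = false ∷ true ∷ true ∷ []
  posBits p4 = true ∷ false ∷ false ∷ []
  posBits p5 = true ∷ false ∷ true ∷ []
  posBits p6 = true ∷ true ∷ false ∷ []
  posBits p7 = true ∷ true ∷ true ∷ []

  bitsPos : Bool → Bool → Bool → Pos
  bitsPos false false false = p0
  bitsPos false false true = p1
  bitsPos false true false = p2
  bitsPos false true true = p3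
  bitsPos true false false = p4
  bitsPos true false true = p5
  bitsPos true true false = p6
  bitsPos true true true = p7

  stateWidth : ℕ
  stateWidth = 17

  encodeState : MState → Vec Bool stateWidth
  encodeState (Sweeping σ) with posBits (pos σ)
  ... | a ∷ b ∷ c ∷ [] = false ∷ false ∷ a ∷ b ∷ c ∷ seek σ ∷ taking σ ∷ isSlot σ ∷ feedsL σ ∷ feedsR σ ∷ o0 σ ∷ o1 σ ∷ o2 σ ∷ lv σ ∷ rv σ ∷ lastValue σ ∷ consumed σ ∷ []
  encodeState Rewinding = true ∷ false ∷ false ∷ false ∷ false ∷ false ∷ false ∷ false ∷ false ∷ false ∷ false ∷ false ∷ false ∷ false ∷ false ∷ false ∷ false ∷ []
  encodeState (Halted b) = true ∷ true ∷ b ∷ false ∷ false ∷ false ∷ false ∷ false ∷ false ∷ false ∷ false ∷ false ∷ false ∷ false ∷ false ∷ false ∷ false ∷ []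

  decodeState : Vec Bool stateWidth → MState
  decodeState (false ∷ _ ∷ a ∷ b ∷ c ∷ s1 ∷ s2 ∷ s3 ∷ s4 ∷ s5 ∷ s6 ∷ s7 ∷ s8 ∷ s9 ∷ s10 ∷ s11 ∷ s12 ∷ []) =
    Sweeping (mkSweep (bitsPos a b c) s1 s2 s3 s4 s5 s6 s7 s8 s9 s10 s11 s12)
  decodeState (true ∷ false ∷ _) = Rewinding
  decodeState (true ∷ true ∷ b ∷ _) = Halted b

  decode-encode : ∀ s → decodeState (encodeState s) ≡ s
  decode-encode (Sweeping (mkSweep p0 _ _ _ _ _ _ _ _ _ _ _ _)) = refl
  decode-encode (Sweeping (mkSweep p1 _ _ _ _ _ _ _ _ _ _ _ _)) = refl
  decode-encode (Sweeping (mkSweep p2 _ _ _ _ _ _ _ _ _ _ _ _)) = refl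
  decode-encode (Sweeping (mkSweep p3 _ _ _ _ _ _ _ _ _ _ _ _)) = refl
  decode-encode (Sweeping (mkSweep p4 _ _ _ _ _ _ _ _ _ _ _ _)) = refl
  decode-encode (Sweeping (mkSweep p5 _ _ _ _ _ _ _ _ _ _ _ _)) = refl
  decode-encode (Sweeping (mkSweep p6 _ _ _ _ _ _ _ _ _ _ _ _)) = refl
  decode-encode (Sweeping (mkSweep p7 _ _ _ _ _ _ _ _ _ _ _ _)) = refl
  decode-encode Rewinding = refl
  decode-encode (Halted b) = refl

  isHalt : MState → Bool
  isHalt (Halted _) = true
  isHalt _ = false

  accOf : MState → Bool
  accOf (Halted b) = b
  accOf _ = false

  transition : MState → Sym → MState × Sym × Dir
  transition (Sweeping σ) blank = if consumed σ then (Rewinding , blank , L) else (Halted (lastValue σ) , blank , S)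
  transition (Sweeping σ) b0 with sweepStep σ false
  ... | y , σ' = Sweeping σ' , bitSym y , R
  transition (Sweeping σ) b1 with sweepStep σ true
  ... | y , σ' = Sweeping σ' , bitSym y , R
  transition Rewinding blank = Sweeping σ₀ , blank , R
  transition Rewinding b0 = Rewinding , b0 , L
  transition Rewinding b1 = Rewinding , b1 , L
  transition (Halted b) a = Halted b , a , S

  stateCode : MState → Fin (2 ^ stateWidth)
  stateCode s = bitsToFin (encodeState s)

  -- Decoding is kept abstract so that the machine's transition function is only
  -- ever unfolded on encoded states.
  abstract
    codeState : Fin (2 ^ stateWidth) → MState
    codeState q = decodeState (finToBits q)

    codeState-stateCode : ∀ s → codeState (stateCode s) ≡ s
    codeState-stateCode s rewrite finToBits-bitsToFin (encodeState s) = decode-encode s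

  evaluator : TM
  evaluator = record
    { Q = 2 ^ stateWidth
    ; start = stateCode (Sweeping σ₀)
    ; δ = λ q a → let r = transition (codeState q) a in stateCode (proj₁ r) , proj₂ r
    ; halts = λ q → isHalt (codeState q)
    ; accept = λ q → accOf (codeState q)
    }

  -- Configurations over the structured state set; they map to configurations of the
  -- machine compatibly with stepping, so all reasoning happens on them.
  record AConf : Set where
    constructor aconf
    field
      st : MState
      lft : List Sym
      hd : Sym
      rgt : List Sym

  stepAbs : AConf → AConf
  stepAbs (aconf s ls a rs) with isHalt s
  ... | true = aconf s ls a rs
  ... | false with transition s a
  ...   | s' , a' , d with move d ls a' rs
  ...     | ls' , h , rs' = aconf s' ls' h rs'

  runAbs : ℕ → AConf → AConf
  runAbs zero c = c
  runAbs (suc t) c = runAbs t (stepAbs c)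

  concretize : AConf → Config evaluator
  concretize (aconf s ls a rs) = cfg (stateCode s) ls a rs

  step-concretize : ∀ c → step evaluator (concretize c) ≡ concretize (stepAbs c)
  step-concretize (aconf s ls a rs) = lemma
    where
    lemma : step evaluator (cfg (stateCode s) ls a rs) ≡ concretize (stepAbs (aconf s ls a rs))
    lemma rewrite codeState-stateCode s with isHalt s
    ... | true = refl
    ... | false rewrite codeState-stateCode s with transition s a
    ...   | s' , a' , d with move d ls a' rs
    ...     | ls' , h , rs' = refl

  run-concretize : ∀ t c → run evaluator t (concretize c) ≡ concretize (runAbs t c)
  run-concretize zero c = refl
  run-concretize (suc t) c rewrite step-concretize c = run-concretize t (stepAbs c)

  runAbs-+ : ∀ a b c → runAbs (a + b) c ≡ runAbs b (runAbs a c)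
  runAbs-+ zero b c = refl
  runAbs-+ (suc a) b c = runAbs-+ a b (stepAbs c)

  atHead : MState → List Sym → List Sym → AConf
  atHead s ls [] = aconf s ls blank []
  atHead s ls (x ∷ xs) = aconf s ls x xs

  symbols : List Bool → List Sym
  symbols = map bitSym

  sweepingStep : ∀ σ d rest ls → stepAbs (aconf (Sweeping σ) ls (bitSym d) rest)
          ≡ atHead (Sweeping (proj₂ (sweepStep σ d))) (bitSym (proj₁ (sweepStep σ d)) ∷ ls) rest
  sweepingStep σ false [] ls = refl
  sweepingStep σ false (x ∷ rest) ls = refl
  sweepingStep σ true [] ls = refl
  sweepingStep σ true (x ∷ rest) ls = refl

  sweepingRun : ∀ Ds σ ls e → runAbs (length Ds) (atHead (Sweeping σ) ls (symbols Ds ++ e))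
           ≡ atHead (Sweeping (sweepEnd σ Ds)) (symbols (sweepOut σ Ds) ʳ++ ls) e
  sweepingRun [] σ ls e = refl
  sweepingRun (d ∷ Ds) σ ls e rewrite sweepingStep σ d (symbols Ds ++ e) ls =
    sweepingRun Ds (proj₂ (sweepStep σ d)) (bitSym (proj₁ (sweepStep σ d)) ∷ ls) e

  sweepStart : Sweep → ℕ → List Bool → ℕ → AConf
  sweepStart σ j Ds k = atHead (Sweeping σ) (replicate j blank) (symbols Ds ++ replicate k blank)

  atHead-blanks : ∀ s LL k → atHead s LL (replicate k blank) ≡ aconf s LL blank (replicate (pred k) blank)
  atHead-blanks s LL zero = refl
  atHead-blanks s LL (suc k) = refl

  unsnoc : ∀ {A : Set} (x : A) xs → Σ (List A) λ Y → Σ A λ h → x ∷ xs ≡ Y ++ (h ∷ [])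
  unsnoc x [] = [] , x , refl
  unsnoc x (y ∷ xs) with unsnoc y xs
  ... | Y , h , eq = x ∷ Y , h , cong (x ∷_) eq

  rewindStep : ∀ y z L0 rest → runAbs 1 (atHead Rewinding (bitSym y ∷ L0) (bitSym z ∷ rest))
               ≡ atHead Rewinding L0 (bitSym y ∷ bitSym z ∷ rest)
  rewindStep y false L0 rest = refl
  rewindStep y true L0 rest = refl

  rewind : ∀ Y h rs L0 → runAbs (length Y) (aconf Rewinding (symbols Y ʳ++ L0) (bitSym h) rs)
         ≡ atHead Rewinding L0 (symbols Y ++ bitSym h ∷ rs)
  rewind [] h rs L0 = refl
  rewind (y ∷ Y) h rs L0 = begin
      runAbs (suc (length Y)) (aconf Rewinding (symbols Y ʳ++ (bitSym y ∷ L0)) (bitSym h) rs)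
    ≡⟨ cong (λ t → runAbs t (aconf Rewinding (symbols Y ʳ++ (bitSym y ∷ L0)) (bitSym h) rs)) (+-comm 1 (length Y)) ⟩
      runAbs (length Y + 1) (aconf Rewinding (symbols Y ʳ++ (bitSym y ∷ L0)) (bitSym h) rs)
    ≡⟨ runAbs-+ (length Y) 1 _ ⟩
      runAbs 1 (runAbs (length Y) (aconf Rewinding (symbols Y ʳ++ (bitSym y ∷ L0)) (bitSym h) rs))
    ≡⟨ cong (runAbs 1) (rewind Y h rs (bitSym y ∷ L0)) ⟩
      runAbs 1 (atHead Rewinding (bitSym y ∷ L0) (symbols Y ++ bitSym h ∷ rs))
    ≡⟨ lem Y ⟩
      atHead Rewinding L0 (symbols (y ∷ Y) ++ bitSym h ∷ rs)
    ∎
    where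
    open ≡-Reasoning
    lem : ∀ Y → runAbs 1 (atHead Rewinding (bitSym y ∷ L0) (symbols Y ++ bitSym h ∷ rs)) ≡ atHead Rewinding L0 (symbols (y ∷ Y) ++ bitSym h ∷ rs)
    lem [] = rewindStep y h L0 rs
    lem (z ∷ Y) = rewindStep y z L0 (symbols Y ++ bitSym h ∷ rs)

  rewind-turn-bit : ∀ b rest j → runAbs 2 (atHead Rewinding (replicate j blank) (bitSym b ∷ rest))
                    ≡ atHead (Sweeping σ₀) (replicate (suc (pred j)) blank) (bitSym b ∷ rest)
  rewind-turn-bit false rest zero = refl
  rewind-turn-bit false rest (suc j) = refl
  rewind-turn-bit true rest zero = refl
  rewind-turn-bit true rest (suc j) = refl

  rewind-turn : ∀ Y h rs j → runAbs 2 (atHead Rewinding (replicate j blank) (symbols Y ++ bitSym h ∷ rs))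
                ≡ atHead (Sweeping σ₀) (replicate (suc (pred j)) blank) (symbols Y ++ bitSym h ∷ rs)
  rewind-turn [] h rs j = rewind-turn-bit h rs j
  rewind-turn (y ∷ Y) h rs j = rewind-turn-bit y (symbols Y ++ bitSym h ∷ rs) j

  symbols-snoc : ∀ Y h rs → symbols Y ++ bitSym h ∷ rs ≡ symbols (Y ++ h ∷ []) ++ rs
  symbols-snoc Y h rs = begin
      symbols Y ++ bitSym h ∷ rs
    ≡⟨ sym (++-assoc (symbols Y) (bitSym h ∷ []) rs) ⟩
      (symbols Y ++ bitSym h ∷ []) ++ rs
    ≡⟨ cong (_++ rs) (sym (map-++ bitSym Y (h ∷ []))) ⟩
      symbols (Y ++ h ∷ []) ++ rs
    ∎
    where open ≡-Reasoning

  turnAtEnd : ∀ σ' Y h j k → consumed σ' ≡ true →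
    runAbs 1 (atHead (Sweeping σ') (symbols (Y ++ h ∷ []) ʳ++ replicate j blank) (replicate k blank))
    ≡ aconf Rewinding (symbols Y ʳ++ replicate j blank) (bitSym h) (replicate (suc (pred k)) blank)
  turnAtEnd σ' Y h j k hc rewrite map-++ bitSym Y (h ∷ []) | ++-ʳ++ (symbols Y) {ys = bitSym h ∷ []} {zs = replicate j blank}
    | atHead-blanks (Sweeping σ') (bitSym h ∷ (symbols Y ʳ++ replicate j blank)) k | hc = refl

  turnBack : ∀ σ' Y h j k → consumed σ' ≡ true →
    runAbs (1 + (length Y + 2)) (atHead (Sweeping σ') (symbols (Y ++ h ∷ []) ʳ++ replicate j blank) (replicate k blank))
    ≡ sweepStart σ₀ (suc (pred j)) (Y ++ h ∷ []) (suc (pred k))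
  turnBack σ' Y h j k hc = begin
      runAbs (1 + (length Y + 2)) c0
    ≡⟨ runAbs-+ 1 (length Y + 2) c0 ⟩
      runAbs (length Y + 2) (runAbs 1 c0)
    ≡⟨ cong (runAbs (length Y + 2)) (turnAtEnd σ' Y h j k hc) ⟩
      runAbs (length Y + 2) (aconf Rewinding (symbols Y ʳ++ replicate j blank) (bitSym h) rs)
    ≡⟨ runAbs-+ (length Y) 2 _ ⟩
      runAbs 2 (runAbs (length Y) (aconf Rewinding (symbols Y ʳ++ replicate j blank) (bitSym h) rs))
    ≡⟨ cong (runAbs 2) (rewind Y h rs (replicate j blank)) ⟩
      runAbs 2 (atHead Rewinding (replicate j blank) (symbols Y ++ bitSym h ∷ rs))
    ≡⟨ rewind-turn Y h rs j ⟩
      atHead (Sweeping σ₀) (replicate (suc (pred j)) blank) (symbols Y ++ bitSym h ∷ rs)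
    ≡⟨ cong (atHead (Sweeping σ₀) (replicate (suc (pred j)) blank)) (symbols-snoc Y h rs) ⟩
      sweepStart σ₀ (suc (pred j)) (Y ++ h ∷ []) (suc (pred k))
    ∎
    where
    open ≡-Reasoning
    rs : List Sym
    rs = replicate (suc (pred k)) blank
    c0 : AConf
    c0 = atHead (Sweeping σ') (symbols (Y ++ h ∷ []) ʳ++ replicate j blank) (replicate k blank)

  sweepOut-snoc : ∀ σ d Ds → Σ (List Bool) λ Y → Σ Bool λ h →
    sweepOut σ (d ∷ Ds) ≡ Y ++ h ∷ [] × length Y + 1 ≡ length (d ∷ Ds)
  sweepOut-snoc σ d Ds with unsnoc (stepOut σ d) (sweepOut (stepNext σ d) Ds)
  ... | Y , h , eo = Y , h , eo , (begin
      length Y + 1           ≡⟨ sym (length-++ Y) ⟩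
      length (Y ++ h ∷ [])    ≡⟨ cong length (sym eo) ⟩
      length (sweepOut σ (d ∷ Ds)) ≡⟨ length-sweepOut σ (d ∷ Ds) ⟩
      length (d ∷ Ds)        ∎)
    where open ≡-Reasoning

  -- A pass over n bits with a turn round after the last one takes 2 n + 2 steps.
  passTime : ∀ {n y} → y + 1 ≡ n → n + (1 + (y + 2)) ≤ 2 * n + 2
  passTime {y = y} refl = ≤-reflexive
    (solve 1 (λ y → (y :+ con 1) :+ (con 1 :+ (y :+ con 2)) := con 2 :* (y :+ con 1) :+ con 2) refl y)

  consumingPass : ∀ σ Ds j k → consumed (sweepEnd σ Ds) ≡ true → (Ds ≡ [] → consumed σ ≡ false) →
    Σ ℕ λ t → t ≤ 2 * length Ds + 2 × runAbs t (sweepStart σ j Ds k) ≡ sweepStart σ₀ (suc (pred j)) (sweepOut σ Ds) (suc (pred k))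
  consumingPass σ [] j k hc hne with trans (sym hc) (hne refl)
  ... | ()
  consumingPass σ (d ∷ Ds) j k hc hne with sweepOut-snoc σ d Ds
  ... | Y , h , eo , lenY = length (d ∷ Ds) + (1 + (length Y + 2)) , passTime lenY , (begin
      runAbs (length (d ∷ Ds) + (1 + (length Y + 2))) (sweepStart σ j (d ∷ Ds) k)
    ≡⟨ runAbs-+ (length (d ∷ Ds)) (1 + (length Y + 2)) (sweepStart σ j (d ∷ Ds) k) ⟩
      runAbs (1 + (length Y + 2)) (runAbs (length (d ∷ Ds)) (sweepStart σ j (d ∷ Ds) k))
    ≡⟨ cong (runAbs (1 + (length Y + 2))) (sweepingRun (d ∷ Ds) σ (replicate j blank) (replicate k blank)) ⟩
      runAbs (1 + (length Y + 2)) (afterSweep (sweepOut σ (d ∷ Ds)))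
    ≡⟨ cong (λ l → runAbs (1 + (length Y + 2)) (afterSweep l)) eo ⟩
      runAbs (1 + (length Y + 2)) (afterSweep (Y ++ h ∷ []))
    ≡⟨ turnBack (sweepEnd σ (d ∷ Ds)) Y h j k hc ⟩
      sweepStart σ₀ (suc (pred j)) (Y ++ h ∷ []) (suc (pred k))
    ≡⟨ cong (λ l → sweepStart σ₀ (suc (pred j)) l (suc (pred k))) (sym eo) ⟩
      sweepStart σ₀ (suc (pred j)) (sweepOut σ (d ∷ Ds)) (suc (pred k))
    ∎)
    where
    open ≡-Reasoning
    afterSweep : List Bool → AConf
    afterSweep out = atHead (Sweeping (sweepEnd σ (d ∷ Ds))) (symbols out ʳ++ replicate j blank) (replicate k blank)

  finalPass : ∀ σ Ds j k → consumed (sweepEnd σ Ds) ≡ false →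
    Σ AConf λ c → runAbs (length Ds + 1) (sweepStart σ j Ds k) ≡ c × AConf.st c ≡ Halted (lastValue (sweepEnd σ Ds))
  finalPass σ Ds j k hc = _ , eq , refl
    where
    eq : runAbs (length Ds + 1) (sweepStart σ j Ds k)
         ≡ aconf (Halted (lastValue (sweepEnd σ Ds))) (symbols (sweepOut σ Ds) ʳ++ replicate j blank) blank (replicate (pred k) blank)
    eq = trans (runAbs-+ (length Ds) 1 (sweepStart σ j Ds k))
          (trans (cong (runAbs 1) (sweepingRun Ds σ (replicate j blank) (replicate k blank)))
            (trans (cong (runAbs 1) (atHead-blanks (Sweeping (sweepEnd σ Ds)) (symbols (sweepOut σ Ds) ʳ++ replicate j blank) k))
               haltAtEnd))
      where
      haltAtEnd : runAbs 1 (aconf (Sweeping (sweepEnd σ Ds)) (symbols (sweepOut σ Ds) ʳ++ replicate j blank) blank (replicate (pred k) blank))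
            ≡ aconf (Halted (lastValue (sweepEnd σ Ds))) (symbols (sweepOut σ Ds) ʳ++ replicate j blank) blank (replicate (pred k) blank)
      haltAtEnd rewrite hc = refl

  halted-step : ∀ c → isHalt (AConf.st c) ≡ true → stepAbs c ≡ c
  halted-step (aconf s ls a rs) h rewrite h = refl

  halted-fix : ∀ t c → isHalt (AConf.st c) ≡ true → runAbs t c ≡ c
  halted-fix zero c h = refl
  halted-fix (suc t) c h rewrite halted-step c h = halted-fix t c h

  Halts : ℕ → AConf → Set
  Halts t c = isHalt (AConf.st (runAbs t c)) ≡ true

  halts-later : ∀ t u c → Halts t c → runAbs (t + u) c ≡ runAbs t c
  halts-later t u c h = trans (runAbs-+ t u c) (halted-fix u (runAbs t c) h)

  halts-same : ∀ t u c → Halts t c → Halts u c → runAbs t c ≡ runAbs u c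
  halts-same t u c ht hu with ≤-total t u
  ... | inj₁ t≤u = sym (trans (cong (λ z → runAbs z c) (sym (m+[n∸m]≡n t≤u))) (halts-later t (u ∸ t) c ht))
  ... | inj₂ u≤t = trans (cong (λ z → runAbs z c) (sym (m+[n∸m]≡n u≤t))) (halts-later u (t ∸ u) c hu)

  -- Every run from the start of a sweep halts: there are at most evenOnes true Ds + 1
  -- sweeps (by the potential), each costing at most 2 |Ds| + 2 steps.
  haltsWithin : ∀ fuel Ds j k → evenOnes true Ds ≤ fuel →
    Σ ℕ λ t → t ≤ (fuel + 1) * (2 * length Ds + 2) × Halts t (sweepStart σ₀ j Ds k)
  haltsWithin fuel Ds j k hf with consumed (sweepEnd σ₀ Ds) in eq
  ... | false with finalPass σ₀ Ds j k eq
  ...   | c , e1 , e2 = length Ds + 1 , bound , subst (λ z → isHalt (AConf.st z) ≡ true) (sym e1) (cong isHalt e2)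
    where
    bound : length Ds + 1 ≤ (fuel + 1) * (2 * length Ds + 2)
    bound = ≤-trans (≤-trans (m≤m+n (length Ds + 1) (length Ds + 1)) (≤-reflexive (dbl (length Ds))))
              (le* fuel (2 * length Ds + 2))
      where
      le* : ∀ a b → b ≤ (a + 1) * b
      le* a b rewrite +-comm a 1 = m≤m+n b (a * b)
      dbl : ∀ a → (a + 1) + (a + 1) ≡ 2 * a + 2
      dbl = solve 1 (λ a → (a :+ con 1) :+ (a :+ con 1) := con 2 :* a :+ con 2) refl
  haltsWithin fuel Ds j k hf | true with consumingPass σ₀ Ds j k eq (λ { refl → refl })
  ... | t₁ , t₁≤ , e1 = result fuel hf
    where
    out : List Bool
    out = sweepOut σ₀ Ds
    lt : evenOnes true out < evenOnes true Ds
    lt = evenOnes-sweep-< σ₀ Ds refl eq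
    result : ∀ fu → evenOnes true Ds ≤ fu → Σ ℕ λ t → t ≤ (fu + 1) * (2 * length Ds + 2) × Halts t (sweepStart σ₀ j Ds k)
    result zero hf' with ≤-trans lt hf'
    ... | ()
    result (suc f) hf' with haltsWithin f out (suc (pred j)) (suc (pred k)) (≤-pred (≤-trans lt hf'))
    ... | t₂ , t₂≤ , h2 = t₁ + t₂ , bnd , hh
      where
      bnd : t₁ + t₂ ≤ (suc f + 1) * (2 * length Ds + 2)
      bnd = +-mono-≤ t₁≤ (≤-trans t₂≤ (≤-reflexive (cong (λ z → (f + 1) * (2 * z + 2)) (length-sweepOut σ₀ Ds))))
      hh : Halts (t₁ + t₂) (sweepStart σ₀ j Ds k)
      hh rewrite runAbs-+ t₁ t₂ (sweepStart σ₀ j Ds k) | e1 = h2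

  timeBound : ℕ → ℕ
  timeBound m = m ^ 10 + 10

  passes≤timeBound : ∀ m → (m + 1) * (2 * m + 2) ≤ timeBound m
  passes≤timeBound zero = ≤ᵇ⇒≤ 2 10 _
  passes≤timeBound (suc zero) = ≤ᵇ⇒≤ 8 11 _
  passes≤timeBound (suc (suc a)) = big (suc (suc a)) (s≤s (s≤s z≤n))
    where
    e1 : ∀ m → (m + m) * (2 * m + 2 * m) ≡ 8 * (m * m)
    e1 = solve 1 (λ m → (m :+ m) :* (con 2 :* m :+ con 2 :* m) := con 8 :* (m :* m)) refl
    e2 : ∀ m → m ^ 8 * (m * m) ≡ m ^ 10
    e2 = solve 1 (λ m → m :^ 8 :* (m :* m) := m :^ 10) refl
    e3 : ∀ m → 2 * m ≡ m + m
    e3 = solve 1 (λ m → con 2 :* m := m :+ m) refl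
    big : ∀ m → 2 ≤ m → (m + 1) * (2 * m + 2) ≤ timeBound m
    big m h = ≤-trans s1 (≤-trans (≤-reflexive (e1 m)) (≤-trans s2 (≤-trans (≤-reflexive (e2 m)) (m≤m+n (m ^ 10) 10))))
      where
      1≤m : 1 ≤ m
      1≤m = ≤-trans (s≤s z≤n) h
      2≤2m : 2 ≤ 2 * m
      2≤2m = ≤-trans h (≤-trans (m≤m+n m m) (≤-reflexive (sym (e3 m))))
      s1 : (m + 1) * (2 * m + 2) ≤ (m + m) * (2 * m + 2 * m)
      s1 = *-mono-≤ (+-monoʳ-≤ m 1≤m) (+-monoʳ-≤ (2 * m) 2≤2m)
      s2 : 8 * (m * m) ≤ m ^ 8 * (m * m)
      s2 = *-monoˡ-≤ (m * m) (≤-trans (≤ᵇ⇒≤ 8 (2 ^ 8) _) (^-monoˡ-≤ 8 {2} {m} h))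

  initial-sweepStart : ∀ l → initial evaluator l ≡ concretize (sweepStart σ₀ 0 l 0)
  initial-sweepStart [] = refl
  initial-sweepStart (b ∷ l) rewrite ++-identityʳ (symbols l) = refl

  CVP : BoolFamily
  CVP m w = accOf (AConf.st (runAbs (timeBound m) (sweepStart σ₀ 0 (toList w) 0)))

  haltTime : ∀ m (w : Vec Bool m) → Σ ℕ λ t → t ≤ timeBound m × Halts t (sweepStart σ₀ 0 (toList w) 0)
  haltTime m w with haltsWithin (length (toList w)) (toList w) 0 0 (evenOnes≤length true (toList w))
  ... | t , t≤ , h = t , ≤-trans t≤ (≤-trans (≤-reflexive (cong (λ z → (z + 1) * (2 * z + 2)) (length-toList w))) (passes≤timeBound m)) , h

  CVP∈P : InP CVP
  CVP∈P = evaluator , 10 , dec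
    where
    dec : DecidesIn evaluator timeBound CVP
    dec m w with haltTime m w
    ... | t , t≤ , h = t , t≤ , hl , ac
      where
      c : AConf
      c = sweepStart σ₀ 0 (toList w) 0
      conf : run evaluator t (initial evaluator (toList w)) ≡ concretize (runAbs t c)
      conf rewrite initial-sweepStart (toList w) = run-concretize t c
      hl : TM.halts evaluator (Config.state (run evaluator t (initial evaluator (toList w)))) ≡ true
      hl rewrite conf | codeState-stateCode (AConf.st (runAbs t c)) = h
      same : runAbs t c ≡ runAbs (timeBound m) c
      same = trans (sym (halted-fix (timeBound m ∸ t) (runAbs t c) h)) (trans (sym (runAbs-+ t (timeBound m ∸ t) c)) (cong (λ z → runAbs z c) (m+[n∸m]≡n t≤)))
      ac : TM.accept evaluator (Config.state (run evaluator t (initial evaluator (toList w)))) ≡ CVP m w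
      ac rewrite conf | codeState-stateCode (AConf.st (runAbs t c)) = cong (λ z → accOf (AConf.st z)) same

-- The tape of a
-- circuit with wire values env (inputs and gates evaluated so far) and remaining
-- program P has one record per wire of the whole circuit; the record of wire a holds
-- p used blocks, one slot per remaining gate, and the current value of wire a (false
-- for wires not yet computed).  The circuit's output is handled by one extra gate
-- AND(i) copying the output wire i to a last wire.  Each consuming sweep evaluates the
-- first remaining gate; the final sweep finds no slot and halts with the last value.
module Evaluation where

  open import Data.Bool using (Bool; true; false; _∧_; if_then_else_)
  open import Data.Bool.Properties using (∧-identityʳ)
  open import Data.Nat using (ℕ; zero; suc; pred; _+_; _∸_; _≤_; _<_; z≤n; s≤s; _≡ᵇ_; _<ᵇ_)
  open import Data.Nat.Properties
  open import Data.Fin using (Fin; toℕ)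
  open import Data.Fin.Properties using (toℕ<n)
  open import Data.Maybe using (Maybe; just; nothing)
  open import Data.List using (List; []; _∷_; _++_; length)
  open import Data.Vec using (Vec; []; _∷_; _∷ʳ_; lookup; toList)
  open import Data.Product using (Σ; _×_; _,_; proj₁; proj₂)
  open import Relation.Binary.PropositionalEquality
  open import Relation.Binary using (tri<; tri≈; tri>)
  open Sweeper
  open TapeFormat
  open Machine

  isWire : ∀ {w} → ℕ → Maybe (Fin w) → Bool
  isWire j nothing = false
  isWire j (just x) = j ≡ᵇ toℕ x

  input₁ input₂ : ∀ {w} → Gate w → Maybe (Fin w)
  input₁ (AND []) = nothing
  input₁ (AND (x ∷ _)) = just x
  input₁ (OR []) = nothing
  input₁ (OR (x ∷ _)) = just x
  input₁ (MAJ _) = nothing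
  input₁ (MOD _ _) = nothing
  input₁ (NOT x) = just x
  input₂ (AND (_ ∷ y ∷ _)) = just y
  input₂ (OR (_ ∷ y ∷ _)) = just y
  input₂ _ = nothing

  opOf : ∀ {w} → Gate w → Op
  opOf (AND []) = AND0
  opOf (AND (_ ∷ [])) = AND1
  opOf (AND (_ ∷ _ ∷ [])) = AND2
  opOf (OR []) = OR0
  opOf (OR (_ ∷ [])) = OR1
  opOf (OR (_ ∷ _ ∷ [])) = OR2
  opOf (NOT _) = NOTo
  opOf _ = NONE

  slotFor : ∀ {w} → ℕ → Gate w → Slot
  slotFor {w} j g = sl (isWire j (input₁ g)) (isWire j (input₂ g)) (if j ≡ᵇ w then opOf g else NONE)

  data Program (w : ℕ) : Set where
    pending : Circuit w → Program w
    finished : Program w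

  headGate : ∀ {w} → Circuit w → Gate w
  headGate (gate g c) = g
  headGate (output i) = AND (i ∷ [])

  restProgram : ∀ {w} → Circuit w → Program (suc w)
  restProgram (gate g c) = pending c
  restProgram (output i) = finished

  slotsOf : ∀ {w} → ℕ → Program w → List Slot
  slotsOf j finished = []
  slotsOf j (pending (gate g c)) = slotFor j g ∷ slotsOf j (pending c)
  slotsOf j (pending (output i)) = slotFor j (AND (i ∷ [])) ∷ []

  -- The number of gates (including the final copy) still to be evaluated.
  programLength : ∀ {w} → Program w → ℕ
  programLength finished = 0
  programLength (pending c) = suc (size c)

  -- The value of wire j, false for wires not computed yet.
  valueAt : ∀ {w} → Vec Bool w → ℕ → Bool
  valueAt [] j = false
  valueAt (b ∷ v) zero = b
  valueAt (b ∷ v) (suc j) = valueAt v j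

  records : ∀ {w} → Vec Bool w → ℕ → Program w → ℕ → ℕ → List Bool
  records env p P a zero = []
  records env p P a (suc k) = wireRecord p (slotsOf a P) (valueAt env a) ++ records env p P (suc a) k

  tape : ∀ {w} → Vec Bool w → ℕ → Program w → List Bool
  tape {w} env p P = records env p P 0 (w + programLength P)

  ≡ᵇ-refl : ∀ a → (a ≡ᵇ a) ≡ true
  ≡ᵇ-refl zero = refl
  ≡ᵇ-refl (suc a) = ≡ᵇ-refl a

  ≡ᵇ-true : ∀ a b → (a ≡ᵇ b) ≡ true → a ≡ b
  ≡ᵇ-true zero zero h = refl
  ≡ᵇ-true zero (suc b) ()
  ≡ᵇ-true (suc a) zero ()
  ≡ᵇ-true (suc a) (suc b) h = cong suc (≡ᵇ-true a b h)

  ltb-suc : ∀ m a → (a ≡ᵇ m) ≡ false → (m <ᵇ suc a) ≡ (m <ᵇ a)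
  ltb-suc zero zero ()
  ltb-suc zero (suc a) h = refl
  ltb-suc (suc m) zero h = refl
  ltb-suc (suc m) (suc a) h = ltb-suc m a h

  ltb-self : ∀ m → (m <ᵇ suc m) ≡ true
  ltb-self zero = refl
  ltb-self (suc m) = ltb-self m

  lt→ltb : ∀ m a → m < a → (m <ᵇ a) ≡ true
  lt→ltb zero (suc a) h = refl
  lt→ltb (suc m) (suc a) (s≤s h) = lt→ltb m a h

  valueAt-lookup : ∀ {w} (env : Vec Bool w) (x : Fin w) → valueAt env (toℕ x) ≡ lookup env x
  valueAt-lookup (b ∷ env) Fin.zero = refl
    where import Data.Fin as Fin
  valueAt-lookup (b ∷ env) (Fin.suc x) = valueAt-lookup env x
    where import Data.Fin as Fin

  valueAt-≥ : ∀ {w} (env : Vec Bool w) a → w ≤ a → valueAt env a ≡ false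
  valueAt-≥ [] a h = refl
  valueAt-≥ (b ∷ env) (suc a) (s≤s h) = valueAt-≥ env a h

  valueAt-snoc-< : ∀ {w} (env : Vec Bool w) b a → a < w → valueAt (env ∷ʳ b) a ≡ valueAt env a
  valueAt-snoc-< (x ∷ env) b zero h = refl
  valueAt-snoc-< (x ∷ env) b (suc a) (s≤s h) = valueAt-snoc-< env b a h

  valueAt-snoc-≡ : ∀ {w} (env : Vec Bool w) b → valueAt (env ∷ʳ b) w ≡ b
  valueAt-snoc-≡ [] b = refl
  valueAt-snoc-≡ (x ∷ env) b = valueAt-snoc-≡ env b

  valueAt-snoc-≢ : ∀ {w} (env : Vec Bool w) b a → (a ≡ᵇ w) ≡ false → valueAt (env ∷ʳ b) a ≡ valueAt env a
  valueAt-snoc-≢ {w} env b a h with <-cmp a w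
  ... | tri< lt _ _ = valueAt-snoc-< env b a lt
  ... | tri≈ _ refl _ with trans (sym h) (≡ᵇ-refl a)
  ...   | ()
  valueAt-snoc-≢ {w} env b a h | tri> _ _ gt = trans (valueAt-≥ (env ∷ʳ b) a gt) (sym (valueAt-≥ env a (<⇒≤ gt)))

  -- Operand values seen by the sweeper before reaching the record of wire a.
  seenInput : ∀ {w} → Vec Bool w → Maybe (Fin w) → ℕ → Bool
  seenInput env nothing a = false
  seenInput env (just x) a = if toℕ x <ᵇ a then lookup env x else false

  inputValue : ∀ {w} → Vec Bool w → Maybe (Fin w) → Bool
  inputValue env nothing = false
  inputValue env (just x) = lookup env x

  seenInput-step : ∀ {w} (env : Vec Bool w) b m a → (if isWire a m then valueAt (env ∷ʳ b) a else seenInput env m a) ≡ seenInput env m (suc a)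
  seenInput-step env b nothing a = refl
  seenInput-step {w} env b (just x) a with a ≡ᵇ toℕ x in eq
  ... | true rewrite ≡ᵇ-true a (toℕ x) eq | ltb-self (toℕ x) =
          trans (valueAt-snoc-< env b (toℕ x) (toℕ<n x)) (valueAt-lookup env x)
  ... | false rewrite ltb-suc (toℕ x) a eq = refl

  seenInput-all : ∀ {w} (env : Vec Bool w) m → seenInput env m w ≡ inputValue env m
  seenInput-all env nothing = refl
  seenInput-all {w} env (just x) rewrite lt→ltb (toℕ x) w (toℕ<n x) = refl

  evalOp-gate : ∀ {w} (env : Vec Bool w) (G : Gate w) → FanIn2 G →
    evalOp (opOf G) (inputValue env (input₁ G)) (inputValue env (input₂ G)) false ≡ evalGate env G
  evalOp-gate env (AND []) h = refl
  evalOp-gate env (AND (x ∷ [])) h = refl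
  evalOp-gate env (AND (x ∷ y ∷ [])) h = refl
  evalOp-gate env (AND (x ∷ y ∷ z ∷ zs)) (s≤s (s≤s ()))
  evalOp-gate env (OR []) h = refl
  evalOp-gate env (OR (x ∷ [])) h = refl
  evalOp-gate env (OR (x ∷ y ∷ [])) h = refl
  evalOp-gate env (OR (x ∷ y ∷ z ∷ zs)) (s≤s (s≤s ()))
  evalOp-gate env (MAJ _) ()
  evalOp-gate env (MOD _ _) ()
  evalOp-gate env (NOT x) h = refl

  slotsOf-pending : ∀ {w} a (c : Circuit w) → slotsOf a (pending c) ≡ slotFor a (headGate c) ∷ slotsOf a (restProgram c)
  slotsOf-pending a (gate g c) = refl
  slotsOf-pending a (output i) = refl

  headValue : ∀ {w} → Vec Bool w → Circuit w → Bool
  headValue env c = evalGate env (headGate c)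

  newValue-correct : ∀ {w} (env : Vec Bool w) (G : Gate w) → FanIn2 G → ∀ a →
    evalOp (if a ≡ᵇ w then opOf G else NONE) (seenInput env (input₁ G) a) (seenInput env (input₂ G) a) (valueAt env a)
    ≡ valueAt (env ∷ʳ evalGate env G) a
  newValue-correct {w} env G hG a with a ≡ᵇ w in eq
  ... | false = sym (valueAt-snoc-≢ env (evalGate env G) a eq)
  ... | true rewrite ≡ᵇ-true a w eq | seenInput-all env (input₁ G) | seenInput-all env (input₂ G) | valueAt-≥ env w ≤-refl
            | valueAt-snoc-≡ env (evalGate env G) = evalOp-gate env G hG

  pass-record : ∀ {w} (env : Vec Bool w) (c : Circuit w) → FanIn2 (headGate c) → ∀ p a ls cs →
    runSweep (atRecord (seenInput env (input₁ (headGate c)) a) (seenInput env (input₂ (headGate c)) a) ls cs) (wireRecord p (slotsOf a (pending c)) (valueAt env a))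
    ≡ (wireRecord (suc p) (slotsOf a (restProgram c)) (valueAt (env ∷ʳ headValue env c) a) ,
       atRecord (seenInput env (input₁ (headGate c)) (suc a)) (seenInput env (input₂ (headGate c)) (suc a)) (valueAt (env ∷ʳ headValue env c) a) true)
  pass-record {w} env c hG p a ls cs rewrite slotsOf-pending a c
    | pass-takingRecord p (isWire a (input₁ (headGate c))) (isWire a (input₂ (headGate c))) (if a ≡ᵇ w then opOf (headGate c) else NONE)
        (slotsOf a (restProgram c)) (valueAt env a) (seenInput env (input₁ (headGate c)) a) (seenInput env (input₂ (headGate c)) a) ls cs
    | newValue-correct env (headGate c) hG a
    | seenInput-step env (headValue env c) (input₁ (headGate c)) a
    | seenInput-step env (headValue env c) (input₂ (headGate c)) a = refl

  consumingSweep-records : ∀ {w} (env : Vec Bool w) (c : Circuit w) → FanIn2 (headGate c) → ∀ p k a ls cs →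
    Σ Sweep λ σf → runSweep (atRecord (seenInput env (input₁ (headGate c)) a) (seenInput env (input₂ (headGate c)) a) ls cs) (records env p (pending c) a (suc k))
       ≡ (records (env ∷ʳ headValue env c) (suc p) (restProgram c) a (suc k) , σf) × consumed σf ≡ true
  consumingSweep-records env c hG p zero a ls cs =
    _ , runSweep-seq _ (wireRecord p (slotsOf a (pending c)) (valueAt env a)) [] (pass-record env c hG p a ls cs) refl , refl
  consumingSweep-records env c hG p (suc k) a ls cs with consumingSweep-records env c hG p k (suc a) (valueAt (env ∷ʳ headValue env c) a) true
  ... | σf , e , hc = σf , runSweep-seq _ (wireRecord p (slotsOf a (pending c)) (valueAt env a)) (records env p (pending c) (suc a) (suc k))
                          (pass-record env c hG p a ls cs) e , hc

  finalSweep-records : ∀ {w} (env : Vec Bool w) p k a lv rv ls cs →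
    runSweep (atRecord lv rv ls cs) (records env p finished a (suc k)) ≡ (records env p finished a (suc k) , atRecord lv rv (valueAt env (k + a)) cs)
  finalSweep-records env p zero a lv rv ls cs = runSweep-seq _ (wireRecord p [] (valueAt env a)) [] (pass-finishedRecord p (valueAt env a) lv rv ls cs) refl
  finalSweep-records env p (suc k) a lv rv ls cs rewrite sym (+-suc k a) =
    runSweep-seq _ (wireRecord p [] (valueAt env a)) (records env p finished (suc a) (suc k)) (pass-finishedRecord p (valueAt env a) lv rv ls cs)
      (finalSweep-records env p k (suc a) lv rv (valueAt env a) cs)

  programLength-rest : ∀ {w} (c : Circuit w) → programLength (restProgram c) ≡ size c
  programLength-rest (gate g c) = refl
  programLength-rest (output i) = refl

  seenInput-none : ∀ {w} (env : Vec Bool w) m → seenInput env m 0 ≡ false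
  seenInput-none env nothing = refl
  seenInput-none env (just x) = refl

  consumingSweep : ∀ {w} (env : Vec Bool w) (c : Circuit w) → FanIn2 (headGate c) → ∀ p →
    sweepOut σ₀ (tape env p (pending c)) ≡ tape (env ∷ʳ headValue env c) (suc p) (restProgram c) × consumed (sweepEnd σ₀ (tape env p (pending c))) ≡ true
  consumingSweep {w} env c hG p with consumingSweep-records env c hG p (w + size c) 0 false false
  ... | σf , e , hc = eqOut , eqCons
    where
    e' : runSweep σ₀ (records env p (pending c) 0 (suc (w + size c)))
       ≡ (records (env ∷ʳ headValue env c) (suc p) (restProgram c) 0 (suc (w + size c)) , σf)
    e' = subst (λ s → runSweep s (records env p (pending c) 0 (suc (w + size c)))
                ≡ (records (env ∷ʳ headValue env c) (suc p) (restProgram c) 0 (suc (w + size c)) , σf))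
           (cong₂ (λ x y → atRecord x y false false) (seenInput-none env (input₁ (headGate c))) (seenInput-none env (input₂ (headGate c)))) e
    lenEq : w + programLength (pending c) ≡ suc (w + size c)
    lenEq = +-suc w (size c)
    lenEq' : suc w + programLength (restProgram c) ≡ suc (w + size c)
    lenEq' = cong (λ z → suc (w + z)) (programLength-rest c)
    eqOut : sweepOut σ₀ (tape env p (pending c)) ≡ tape (env ∷ʳ headValue env c) (suc p) (restProgram c)
    eqOut = trans (cong (λ n → sweepOut σ₀ (records env p (pending c) 0 n)) lenEq)
              (trans (cong proj₁ e') (cong (λ n → records (env ∷ʳ headValue env c) (suc p) (restProgram c) 0 n) (sym lenEq')))
    eqCons : consumed (sweepEnd σ₀ (tape env p (pending c))) ≡ true
    eqCons = trans (cong (λ n → consumed (sweepEnd σ₀ (records env p (pending c) 0 n))) lenEq) (trans (cong (λ z → consumed (proj₂ z)) e') hc)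

  finalSweep : ∀ {w} (env : Vec Bool w) b p →
    consumed (sweepEnd σ₀ (tape (env ∷ʳ b) p finished)) ≡ false × lastValue (sweepEnd σ₀ (tape (env ∷ʳ b) p finished)) ≡ b
  finalSweep {w} env b p = cong (λ z → consumed (proj₂ z)) e , trans (cong (λ z → lastValue (proj₂ z)) e) lastEq
    where
    e : runSweep (atRecord false false false false) (records (env ∷ʳ b) p finished 0 (suc (w + 0)))
        ≡ (records (env ∷ʳ b) p finished 0 (suc (w + 0)) , atRecord false false (valueAt (env ∷ʳ b) (w + 0 + 0)) false)
    e = finalSweep-records (env ∷ʳ b) p (w + 0) 0 false false false false
    lastEq : valueAt (env ∷ʳ b) (w + 0 + 0) ≡ b
    lastEq rewrite +-identityʳ (w + 0) | +-identityʳ w = valueAt-snoc-≡ env b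

  answerAt : ℕ → AConf → Bool
  answerAt t c = accOf (AConf.st (runAbs t c))

  evaluates : ∀ {w} (c : Circuit w) → AllGates FanIn2 c → (env : Vec Bool w) → ∀ p j k →
    Σ ℕ λ t → Halts t (sweepStart σ₀ j (tape env p (pending c)) k) × answerAt t (sweepStart σ₀ j (tape env p (pending c)) k) ≡ eval c env
  evaluates {w} (gate g c) (hg , hc) env p j k with consumingSweep env (gate g c) hg p
  ... | eo , ec with consumingPass σ₀ (tape env p (pending (gate g c))) j k ec (λ _ → refl)
  ...   | t₁ , _ , e1 with evaluates c hc (env ∷ʳ evalGate env g) (suc p) (suc (pred j)) (suc (pred k))
  ...     | t₂ , h2 , a2 = t₁ + t₂ , hh , aa
    where
    S0 : AConf
    S0 = sweepStart σ₀ j (tape env p (pending (gate g c))) k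
    mid : runAbs t₁ S0 ≡ sweepStart σ₀ (suc (pred j)) (tape (env ∷ʳ evalGate env g) (suc p) (pending c)) (suc (pred k))
    mid = trans e1 (cong (λ z → sweepStart σ₀ (suc (pred j)) z (suc (pred k))) eo)
    tot : runAbs (t₁ + t₂) S0 ≡ runAbs t₂ (sweepStart σ₀ (suc (pred j)) (tape (env ∷ʳ evalGate env g) (suc p) (pending c)) (suc (pred k)))
    tot = trans (runAbs-+ t₁ t₂ S0) (cong (runAbs t₂) mid)
    hh : Halts (t₁ + t₂) S0
    hh rewrite tot = h2
    aa : answerAt (t₁ + t₂) S0 ≡ eval c (env ∷ʳ evalGate env g)
    aa rewrite tot = a2
  evaluates {w} (output i) hc env p j k with consumingSweep env (output i) (s≤s z≤n) p
  ... | eo , ec with consumingPass σ₀ (tape env p (pending (output i))) j k ec (λ _ → refl)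
  ...   | t₁ , _ , e1 with finalSweep env (lookup env i ∧ true) (suc p)
  ...     | cf , lf with finalPass σ₀ (tape (env ∷ʳ (lookup env i ∧ true)) (suc p) finished) (suc (pred j)) (suc (pred k)) cf
  ...       | cc , e2 , st2 = t₁ + t₂ , hh , aa
    where
    S0 : AConf
    S0 = sweepStart σ₀ j (tape env p (pending (output i))) k
    D1 : List Bool
    D1 = tape (env ∷ʳ (lookup env i ∧ true)) (suc p) finished
    t₂ : ℕ
    t₂ = length D1 + 1
    mid : runAbs t₁ S0 ≡ sweepStart σ₀ (suc (pred j)) D1 (suc (pred k))
    mid = trans e1 (cong (λ z → sweepStart σ₀ (suc (pred j)) z (suc (pred k))) eo)
    tot : runAbs (t₁ + t₂) S0 ≡ cc
    tot = trans (runAbs-+ t₁ t₂ S0) (trans (cong (runAbs t₂) mid) e2)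
    hh : Halts (t₁ + t₂) S0
    hh rewrite tot | st2 = refl
    aa : answerAt (t₁ + t₂) S0 ≡ lookup env i
    aa rewrite tot | st2 = trans lf (∧-identityʳ (lookup env i))

  CVP-correct : ∀ m (v : Vec Bool m) {n} (c : Circuit n) → AllGates FanIn2 c → (x : Vec Bool n) →
    toList v ≡ tape x 0 (pending c) → CVP m v ≡ eval c x
  CVP-correct m v c hc x ev with haltTime m v | evaluates c hc x 0 0 0
  ... | t₁ , t₁≤ , h1 | t₀ , h0 , a0 = trans readEarlier (trans sameAnswer a0)
    where
    SS SS' : AConf
    SS = sweepStart σ₀ 0 (toList v) 0
    SS' = sweepStart σ₀ 0 (tape x 0 (pending c)) 0
    eS : SS ≡ SS'
    eS = cong (λ z → sweepStart σ₀ 0 z 0) ev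
    readEarlier : CVP m v ≡ answerAt t₁ SS
    readEarlier = cong (λ z → accOf (AConf.st z)) (trans (cong (λ z → runAbs z SS) (sym (m+[n∸m]≡n t₁≤))) (halts-later t₁ (timeBound m ∸ t₁) SS h1))
    h0' : Halts t₀ SS
    h0' = subst (Halts t₀) (sym eS) h0
    sameAnswer : answerAt t₁ SS ≡ answerAt t₀ SS'
    sameAnswer = trans (cong (λ z → accOf (AConf.st z)) (halts-same t₁ t₀ SS h1 h0')) (cong (answerAt t₀) eS)

-- Circuits under renaming of wires, and restriction by a projection ρ, which assigns
-- to each of the m input wires either a constant or one of n new input wires.  The
-- restriction adds two gates computing the constants true and false; it preserves
-- size up to these two gates, depth up to 2, and every class of gates closed under
-- renaming that contains AND() and NOT.
module Projection where

  open import Data.Bool using (Bool; true; false; not)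
  open import Data.Nat using (ℕ; zero; suc; _+_; _*_; _≤_; _≤ᵇ_; z≤n; s≤s)
  open import Data.Nat.Properties
  open import Data.Fin using (Fin; fromℕ; inject₁)
  import Data.Fin as F
  open import Data.Sum using (_⊎_; inj₁; inj₂)
  open import Data.List using (List; []; _∷_; map)
  open import Data.List.Properties using (length-map)
  open import Data.Vec using (Vec; []; _∷_; _∷ʳ_; lookup; tabulate)
  open import Data.Vec.Properties using (lookup∘tabulate; tabulate-cong; tabulate∘lookup; tabulate-∘)
  open import Relation.Binary.PropositionalEquality
  open import Data.Product using (_,_)
  open import Function using (_∘_)

  data View : ∀ {w} → Fin (suc w) → Set where
    vlast : ∀ {w} → View (fromℕ w)
    vinj : ∀ {w} (j : Fin w) → View (inject₁ j)

  view : ∀ {w} (i : Fin (suc w)) → View i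
  view {zero} F.zero = vlast
  view {suc w} F.zero = vinj F.zero
  view {suc w} (F.suc i) with view i
  ... | vlast = vlast
  ... | vinj j = vinj (F.suc j)

  lookup-last : ∀ {A : Set} {w} (v : Vec A w) b → lookup (v ∷ʳ b) (fromℕ w) ≡ b
  lookup-last [] b = refl
  lookup-last (x ∷ v) b = lookup-last v b

  lookup-inj : ∀ {A : Set} {w} (v : Vec A w) b (j : Fin w) → lookup (v ∷ʳ b) (inject₁ j) ≡ lookup v j
  lookup-inj (x ∷ v) b F.zero = refl
  lookup-inj (x ∷ v) b (F.suc j) = lookup-inj v b j

  extend : ∀ {w w'} → (Fin w → Fin w') → Fin (suc w) → Fin (suc w')
  extend {w} {w'} r i with view i
  ... | vlast = fromℕ w'
  ... | vinj j = inject₁ (r j)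

  lookup-ext : ∀ {A : Set} {w w'} (r : Fin w → Fin w') (v : Vec A w') b (i : Fin (suc w)) →
    lookup (v ∷ʳ b) (extend r i) ≡ lookup (tabulate (lookup v ∘ r) ∷ʳ b) i
  lookup-ext {w = w} {w'} r v b i with view i
  ... | vlast = trans (lookup-last v b) (sym (lookup-last (tabulate (lookup v ∘ r)) b))
  ... | vinj j = trans (lookup-inj v b (r j)) (trans (sym (lookup∘tabulate (lookup v ∘ r) j)) (sym (lookup-inj (tabulate (lookup v ∘ r)) b j)))

  renameGate : ∀ {w w'} → (Fin w → Fin w') → Gate w → Gate w'
  renameGate r (AND is) = AND (map r is)
  renameGate r (OR is) = OR (map r is)
  renameGate r (MAJ is) = MAJ (map r is)
  renameGate r (MOD m is) = MOD m (map r is)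
  renameGate r (NOT i) = NOT (r i)

  rename : ∀ {w w'} → (Fin w → Fin w') → Circuit w → Circuit w'
  rename r (output i) = output (r i)
  rename r (gate g c) = gate (renameGate r g) (rename (extend r) c)

  map-lookup-rename : ∀ {w w'} (r : Fin w → Fin w') (v : Vec Bool w') (is : List (Fin w)) →
    map (lookup v) (map r is) ≡ map (lookup (tabulate (lookup v ∘ r))) is
  map-lookup-rename r v [] = refl
  map-lookup-rename r v (i ∷ is) = cong₂ _∷_ (sym (lookup∘tabulate (lookup v ∘ r) i)) (map-lookup-rename r v is)

  evalGate-rename : ∀ {w w'} (r : Fin w → Fin w') (v : Vec Bool w') g →
    evalGate v (renameGate r g) ≡ evalGate (tabulate (lookup v ∘ r)) g
  evalGate-rename r v (AND is) = cong andL (map-lookup-rename r v is)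
  evalGate-rename r v (OR is) = cong orL (map-lookup-rename r v is)
  evalGate-rename r v (MAJ is) = cong₂ (λ a b → a ≤ᵇ (2 * countTrue b)) (length-map r is) (map-lookup-rename r v is)
  evalGate-rename r v (MOD m is) = cong (λ b → modTest m (countTrue b)) (map-lookup-rename r v is)
  evalGate-rename r v (NOT i) = cong not (sym (lookup∘tabulate (lookup v ∘ r) i))

  eval-rename : ∀ {w w'} (r : Fin w → Fin w') (c : Circuit w) (v : Vec Bool w') →
    eval (rename r c) v ≡ eval c (tabulate (lookup v ∘ r))
  eval-rename r (output i) v = sym (lookup∘tabulate (lookup v ∘ r) i)
  eval-rename r (gate g c) v = trans (eval-rename (extend r) c (v ∷ʳ evalGate v (renameGate r g)))
    (cong (eval c) (trans (tabulate-cong (lookup-ext r v (evalGate v (renameGate r g))))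
       (trans (tabulate∘lookup _) (cong (tabulate (lookup v ∘ r) ∷ʳ_) (evalGate-rename r v g)))))

  size-rename : ∀ {w w'} (r : Fin w → Fin w') (c : Circuit w) → size (rename r c) ≡ size c
  size-rename r (output i) = refl
  size-rename r (gate g c) = cong suc (size-rename (extend r) c)

  maxL-rename : ∀ {w w'} (r : Fin w → Fin w') (ds' : Vec ℕ w') (ds : Vec ℕ w) K →
    (∀ i → lookup ds' (r i) ≤ lookup ds i + K) → ∀ is →
    maxL (map (lookup ds') (map r is)) ≤ maxL (map (lookup ds) is) + K
  maxL-rename r ds' ds K h [] = z≤n
  maxL-rename r ds' ds K h (i ∷ is) = ⊔-lub
    (≤-trans (h i) (+-monoˡ-≤ K (m≤m⊔n (lookup ds i) _)))
    (≤-trans (maxL-rename r ds' ds K h is) (+-monoˡ-≤ K (m≤n⊔m (lookup ds i) _)))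

  gateDepth-rename : ∀ {w w'} (r : Fin w → Fin w') (ds' : Vec ℕ w') (ds : Vec ℕ w) K →
    (∀ i → lookup ds' (r i) ≤ lookup ds i + K) → ∀ g →
    gateDepth ds' (renameGate r g) ≤ gateDepth ds g + K
  gateDepth-rename r ds' ds K h (AND is) = s≤s (maxL-rename r ds' ds K h is)
  gateDepth-rename r ds' ds K h (OR is) = s≤s (maxL-rename r ds' ds K h is)
  gateDepth-rename r ds' ds K h (MAJ is) = s≤s (maxL-rename r ds' ds K h is)
  gateDepth-rename r ds' ds K h (MOD _ is) = s≤s (maxL-rename r ds' ds K h is)
  gateDepth-rename r ds' ds K h (NOT i) = s≤s (h i)

  depth-rename : ∀ {w w'} (r : Fin w → Fin w') (c : Circuit w) (ds' : Vec ℕ w') (ds : Vec ℕ w) K →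
    (∀ i → lookup ds' (r i) ≤ lookup ds i + K) → depthFrom ds' (rename r c) ≤ depthFrom ds c + K
  depth-rename r (output i) ds' ds K h = h i
  depth-rename r (gate g c) ds' ds K h = depth-rename (extend r) c _ _ K h'
    where
    h' : ∀ i → lookup (ds' ∷ʳ gateDepth ds' (renameGate r g)) (extend r i) ≤ lookup (ds ∷ʳ gateDepth ds g) i + K
    h' i with view i
    ... | vlast {w} rewrite lookup-last ds' (gateDepth ds' (renameGate r g)) | lookup-last ds (gateDepth ds g) = gateDepth-rename r ds' ds K h g
    ... | vinj j rewrite lookup-inj ds' (gateDepth ds' (renameGate r g)) (r j) | lookup-inj ds (gateDepth ds g) j = h j

  record Closed (P : ∀ {w} → Gate w → Set) : Set where
    field
      renameP : ∀ {w w'} (r : Fin w → Fin w') g → P g → P (renameGate r g)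
      and0 : ∀ {w} → P {w} (AND [])
      not1 : ∀ {w} (i : Fin w) → P (NOT i)
  open Closed public

  AllGates-rename : ∀ {P : ∀ {w} → Gate w → Set} → Closed P → ∀ {w w'} (r : Fin w → Fin w') (c : Circuit w) →
    AllGates P c → AllGates P (rename r c)
  AllGates-rename cl r (output i) h = h
  AllGates-rename cl r (gate g c) (hg , hc) = renameP cl r g hg , AllGates-rename cl (extend r) c hc

  closedFanIn2 : Closed FanIn2
  closedFanIn2 = record { renameP = rp ; and0 = z≤n ; not1 = λ _ → tt }
    where
    rp : ∀ {w w'} (r : Fin w → Fin w') g → FanIn2 g → FanIn2 (renameGate r g)
    rp r (AND is) h rewrite length-map r is = h
    rp r (OR is) h rewrite length-map r is = h
    rp r (MAJ is) ()
    rp r (MOD _ is) ()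
    rp r (NOT i) h = h

  closedAC : Closed ACGate
  closedAC = record { renameP = rp ; and0 = tt ; not1 = λ _ → tt }
    where
    rp : ∀ {w w'} (r : Fin w → Fin w') g → ACGate g → ACGate (renameGate r g)
    rp r (AND is) h = h
    rp r (OR is) h = h
    rp r (MAJ is) ()
    rp r (MOD _ is) ()
    rp r (NOT i) h = h

  closedACC : ∀ m → Closed (ACCGate m)
  closedACC m = record { renameP = rp ; and0 = tt ; not1 = λ _ → tt }
    where
    rp : ∀ {w w'} (r : Fin w → Fin w') g → ACCGate m g → ACCGate m (renameGate r g)
    rp r (AND is) h = h
    rp r (OR is) h = h
    rp r (MAJ is) ()
    rp r (MOD _ is) h = h
    rp r (NOT i) h = h

  closedTC : Closed TCGate
  closedTC = record { renameP = rp ; and0 = tt ; not1 = λ _ → tt }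
    where
    rp : ∀ {w w'} (r : Fin w → Fin w') g → TCGate g → TCGate (renameGate r g)
    rp r (AND is) h = h
    rp r (OR is) h = h
    rp r (MAJ is) h = h
    rp r (MOD _ is) ()
    rp r (NOT i) h = h

  resolve : ∀ {n} → Vec Bool n → Bool ⊎ Fin n → Bool
  resolve x (inj₁ b) = b
  resolve x (inj₂ i) = lookup x i

  source : ∀ {n} → Bool ⊎ Fin n → Fin (suc (suc n))
  source {n} (inj₁ true) = inject₁ (fromℕ n)
  source {n} (inj₁ false) = fromℕ (suc n)
  source {n} (inj₂ i) = inject₁ (inject₁ i)

  restrict : ∀ {m n} → Vec (Bool ⊎ Fin n) m → Circuit m → Circuit n
  restrict {m} {n} ρ c = gate (AND []) (gate (NOT (fromℕ n)) (rename (λ k → source (lookup ρ k)) c))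

  restrict-eval : ∀ {m n} (ρ : Vec (Bool ⊎ Fin n) m) c (x : Vec Bool n) →
    eval (restrict ρ c) x ≡ eval c (Data.Vec.map (resolve x) ρ)
  restrict-eval {m} {n} ρ c x = trans (eval-rename (λ k → source (lookup ρ k)) c env2)
    (cong (eval c) (trans (tabulate-cong (λ k → pk (lookup ρ k)))
      (trans (tabulate-∘ (resolve x) (lookup ρ)) (cong (Data.Vec.map (resolve x)) (tabulate∘lookup ρ)))))
    where
    env2 : Vec Bool (suc (suc n))
    env2 = (x ∷ʳ true) ∷ʳ not (lookup (x ∷ʳ true) (fromℕ n))
    pk : ∀ u → lookup env2 (source u) ≡ resolve x u
    pk (inj₁ true) = trans (lookup-inj (x ∷ʳ true) _ (fromℕ n)) (lookup-last x true)
    pk (inj₁ false) rewrite lookup-last (x ∷ʳ true) (not (lookup (x ∷ʳ true) (fromℕ n))) | lookup-last x true = refl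
    pk (inj₂ i) = trans (lookup-inj (x ∷ʳ true) _ (inject₁ i)) (lookup-inj x true i)

  restrict-size : ∀ {m n} (ρ : Vec (Bool ⊎ Fin n) m) c → size (restrict ρ c) ≡ 2 + size c
  restrict-size ρ c = cong (λ z → suc (suc z)) (size-rename _ c)

  lookup-zeros : ∀ m (k : Fin m) → lookup (zeros m) k ≡ 0
  lookup-zeros (suc m) F.zero = refl
  lookup-zeros (suc m) (F.suc k) = lookup-zeros m k

  restrict-depth : ∀ {m n} (ρ : Vec (Bool ⊎ Fin n) m) c → depth (restrict ρ c) ≤ depth c + 2
  restrict-depth {m} {n} ρ c = depth-rename (λ k → source (lookup ρ k)) c dsN (zeros m) 2 h
    where
    ds1 : Vec ℕ (suc n)
    ds1 = zeros n ∷ʳ suc (maxL [])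
    dsN : Vec ℕ (suc (suc n))
    dsN = ds1 ∷ʳ suc (lookup ds1 (fromℕ n))
    pk : ∀ u → lookup dsN (source u) ≤ 2
    pk (inj₁ true) rewrite lookup-inj ds1 (suc (lookup ds1 (fromℕ n))) (fromℕ n) | lookup-last (zeros n) 1 = s≤s z≤n
    pk (inj₁ false) rewrite lookup-last ds1 (suc (lookup ds1 (fromℕ n))) | lookup-last (zeros n) 1 = ≤-refl
    pk (inj₂ i) rewrite lookup-inj ds1 (suc (lookup ds1 (fromℕ n))) (inject₁ i) | lookup-inj (zeros n) 1 i | lookup-zeros n i = z≤n
    h : ∀ k → lookup dsN (source (lookup ρ k)) ≤ lookup (zeros m) k + 2
    h k rewrite lookup-zeros m k = pk (lookup ρ k)

  restrict-gates : ∀ {P : ∀ {w} → Gate w → Set} → Closed P → ∀ {m n} (ρ : Vec (Bool ⊎ Fin n) m) c →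
    AllGates P c → AllGates P (restrict ρ c)
  restrict-gates cl ρ c h = and0 cl , not1 cl _ , AllGates-rename cl _ c h

-- The tape of a circuit c on inputs x is a projection of x: a fixed list tapeTemplate c of
-- constants and input positions, of length (n + s + 1)(8s + 16) for size s.
module Padding where

  open import Data.Bool using (Bool; false)
  open import Data.Nat using (ℕ; zero; suc; _+_; _*_)
  open import Data.Nat.Properties using (+-suc; +-comm; +-assoc; *-suc)
  open import Data.Fin using (Fin)
  open import Data.Sum using (_⊎_; inj₁; inj₂; map₂)
  open import Data.List using (List; []; _∷_; _++_; map; length)
  open import Data.List.Properties using (++-assoc; map-++; map-id; map-∘; length-++; length-map)
  open import Data.Vec using (Vec; []; _∷_)
  open import Relation.Binary.PropositionalEquality
  open TapeFormat
  open Evaluation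
  open Projection using (resolve)

  valueSource : ∀ n → ℕ → Bool ⊎ Fin n
  valueSource zero a = inj₁ false
  valueSource (suc n) zero = inj₂ Fin.zero
    where import Data.Fin as Fin
  valueSource (suc n) (suc a) = map₂ Fin.suc (valueSource n a)
    where import Data.Fin as Fin

  resolve-valueSource : ∀ {n} (x : Vec Bool n) a → resolve x (valueSource n a) ≡ valueAt x a
  resolve-valueSource [] a = refl
  resolve-valueSource (b ∷ x) zero = refl
  resolve-valueSource {suc n} (b ∷ x) (suc a) = trans (lem (valueSource n a)) (resolve-valueSource x a)
    where
    lem : ∀ (u : Bool ⊎ Fin n) → resolve (b ∷ x) (map₂ Fin.suc u) ≡ resolve x u
    lem (inj₁ _) = refl
    lem (inj₂ _) = refl

  recordsTemplate : ∀ {n} → Program n → ℕ → ℕ → List (Bool ⊎ Fin n)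
  recordsTemplate {n} P a zero = []
  recordsTemplate {n} P a (suc k) = map inj₁ (slotsBits (slotsOf a P) ++ padding₇) ++ (valueSource n a ∷ recordsTemplate P (suc a) k)

  recordsTemplate-correct : ∀ {n} (x : Vec Bool n) (P : Program n) a k → map (resolve x) (recordsTemplate P a k) ≡ records x 0 P a k
  recordsTemplate-correct x P a zero = refl
  recordsTemplate-correct {n} x P a (suc k) = begin
      map (resolve x) (map inj₁ pre ++ (valueSource n a ∷ recordsTemplate P (suc a) k))
    ≡⟨ map-++ (resolve x) (map inj₁ pre) (valueSource n a ∷ recordsTemplate P (suc a) k) ⟩
      map (resolve x) (map inj₁ pre) ++ (resolve x (valueSource n a) ∷ map (resolve x) (recordsTemplate P (suc a) k))
    ≡⟨ cong₂ (λ u v → u ++ v) m1 (cong₂ _∷_ (resolve-valueSource x a) (recordsTemplate-correct x P (suc a) k)) ⟩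
      pre ++ (valueAt x a ∷ records x 0 P (suc a) k)
    ≡⟨ sym (++-assoc pre (valueAt x a ∷ []) (records x 0 P (suc a) k)) ⟩
      (pre ++ valueAt x a ∷ []) ++ records x 0 P (suc a) k
    ≡⟨ cong (_++ records x 0 P (suc a) k) (++-assoc (slotsBits (slotsOf a P)) padding₇ (valueAt x a ∷ [])) ⟩
      wireRecord 0 (slotsOf a P) (valueAt x a) ++ records x 0 P (suc a) k
    ∎
    where
    open ≡-Reasoning
    pre : List Bool
    pre = slotsBits (slotsOf a P) ++ padding₇
    m1 : map (resolve x) (map inj₁ pre) ≡ pre
    m1 = trans (sym (map-∘ pre)) (map-id pre)

  tapeTemplate : ∀ {n} → Circuit n → List (Bool ⊎ Fin n)
  tapeTemplate {n} c = recordsTemplate (pending c) 0 (n + programLength (pending c))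

  tapeTemplate-correct : ∀ {n} (x : Vec Bool n) (c : Circuit n) → map (resolve x) (tapeTemplate c) ≡ tape x 0 (pending c)
  tapeTemplate-correct {n} x c = recordsTemplate-correct x (pending c) 0 (n + programLength (pending c))

  -- The length of the tape: one record of 8 (s + 2) bits for each of n + s + 1 wires.
  length-slotsOf : ∀ {w} a (P : Program w) → length (slotsOf a P) ≡ programLength P
  length-slotsOf a finished = refl
  length-slotsOf a (pending (gate g c)) = cong suc (length-slotsOf a (pending c))
  length-slotsOf a (pending (output i)) = refl

  length-slotsBits : ∀ ss → length (slotsBits ss) ≡ 8 * length ss
  length-slotsBits [] = refl
  length-slotsBits (sl l r o ∷ ss) rewrite length-slotsBits ss = sym (*-suc 8 (length ss))

  length-recordsTemplate : ∀ {n} (P : Program n) a k → length (recordsTemplate P a k) ≡ k * (8 * programLength P + 8)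
  length-recordsTemplate P a zero = refl
  length-recordsTemplate {n} P a (suc k) = begin
      length (map inj₁ (slotsBits (slotsOf a P) ++ padding₇) ++ (valueSource n a ∷ recordsTemplate P (suc a) k))
    ≡⟨ length-++ (map inj₁ (slotsBits (slotsOf a P) ++ padding₇)) ⟩
      length (map inj₁ (slotsBits (slotsOf a P) ++ padding₇)) + suc (length (recordsTemplate P (suc a) k))
    ≡⟨ cong₂ (λ u v → u + suc v) (trans (length-map inj₁ (slotsBits (slotsOf a P) ++ padding₇))
          (trans (length-++ (slotsBits (slotsOf a P)))
            (cong (_+ 7) (trans (length-slotsBits (slotsOf a P)) (cong (8 *_) (length-slotsOf a P))))))
         (length-recordsTemplate P (suc a) k) ⟩
      8 * programLength P + 7 + suc (k * (8 * programLength P + 8))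
    ≡⟨ regroup (8 * programLength P) (k * (8 * programLength P + 8)) ⟩
      (8 * programLength P + 8) + k * (8 * programLength P + 8)
    ∎
    where
    open ≡-Reasoning
    regroup : ∀ u v → u + 7 + suc v ≡ (u + 8) + v
    regroup u v = trans (+-suc (u + 7) v) (cong (_+ v) (trans (+-comm 1 (u + 7)) (+-assoc u 7 1)))

  length-tapeTemplate : ∀ {n} (c : Circuit n) → length (tapeTemplate c) ≡ (n + suc (size c)) * (8 * suc (size c) + 8)
  length-tapeTemplate {n} c = length-recordsTemplate (pending c) 0 (n + programLength (pending c))

module Bounds where

  open import Data.Nat using (ℕ; zero; suc; _+_; _*_; _^_; _≤_; z≤n; s≤s; ⌈_/2⌉)
  open import Data.Nat.Properties
  open import Data.Nat.Logarithm
  open import Data.Product using (_,_)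
  open import Relation.Binary.PropositionalEquality
  open import Data.Nat.Solver using (module +-*-Solver)
  open +-*-Solver

  1≤2^ : ∀ k → 1 ≤ 2 ^ k
  1≤2^ zero = ≤-refl
  1≤2^ (suc k) = ≤-trans (1≤2^ k) (m≤m+n (2 ^ k) _)

  log-pos : ∀ n → 2 ≤ n → 1 ≤ ⌈log₂ n ⌉
  log-pos n h = subst (_≤ ⌈log₂ n ⌉) (⌈log₂2^n⌉≡n 1) (⌈log₂⌉-mono-≤ h)

  -- By induction on n (with explicit fuel), halving n and using ⌈log₂ ⌈n/2⌉⌉ = ⌈log₂ n⌉ - 1.
  n≤2^log : ∀ fuel n → n ≤ fuel → n ≤ 2 ^ ⌈log₂ n ⌉
  n≤2^log fuel zero h = z≤n
  n≤2^log fuel (suc zero) h = ≤-refl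
  n≤2^log zero (suc (suc k)) ()
  n≤2^log (suc fuel) (suc (suc k)) (s≤s h) = ≤-trans n≤2h (≤-trans (*-monoʳ-≤ 2 ih) (≤-reflexive eq))
    where
    n h2 LL : ℕ
    n = suc (suc k)
    h2 = ⌈ n /2⌉
    LL = ⌈log₂ n ⌉
    ih : h2 ≤ 2 ^ ⌈log₂ h2 ⌉
    ih = n≤2^log fuel h2 (≤-trans (≤-pred (⌈n/2⌉<n k)) h)
    n≤2h : n ≤ 2 * h2
    n≤2h = ≤-trans (≤-reflexive (sym (⌊n/2⌋+⌈n/2⌉≡n n))) (≤-trans (+-monoˡ-≤ h2 (⌊n/2⌋≤⌈n/2⌉ n)) (≤-reflexive (cong (h2 +_) (sym (+-identityʳ h2)))))
    Lpos : 1 ≤ LL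
    Lpos = log-pos n (s≤s (s≤s z≤n))
    eq : 2 * 2 ^ ⌈log₂ h2 ⌉ ≡ 2 ^ LL
    eq rewrite ⌈log₂⌈n/2⌉⌉≡⌈log₂n⌉∸1 n = cong (2 ^_) (m+[n∸m]≡n Lpos)

  n≤2^⌈log₂n⌉ : ∀ n → n ≤ 2 ^ ⌈log₂ n ⌉
  n≤2^⌈log₂n⌉ n = n≤2^log n n ≤-refl

  pow-mono-exp : ∀ n {a b} → 1 ≤ n → a ≤ b → n ^ a ≤ n ^ b
  pow-mono-exp (suc n) h ab = ^-monoʳ-≤ (suc n) ab

  pow-pos : ∀ n a → 1 ≤ n → 1 ≤ n ^ a
  pow-pos n a h = ≤-trans (≤-reflexive (sym (^-zeroˡ a))) (^-monoˡ-≤ a h)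

  -- The estimate for fixed n, with L = ⌈log₂ n⌉ ≥ 82.  Writing e = L^d and S = n^e,
  -- the tape length is at most 72 S² ≤ n^F with F = 7 + 2e, so m^{log m} ≤ n^A with
  -- A = F · L · F ≤ 81 L^{2d+1}, and A + 1 ≤ L^{2d+2}.
  module Core (n LL d : ℕ) (n≥2 : 2 ≤ n) (L≥82 : 82 ≤ LL) (n≤ : n ≤ 2 ^ LL) where
    1≤n : 1 ≤ n
    1≤n = ≤-trans (s≤s z≤n) n≥2
    1≤L : 1 ≤ LL
    1≤L = ≤-trans (s≤s z≤n) L≥82
    e : ℕ
    e = LL ^ d
    1≤e : 1 ≤ e
    1≤e = pow-pos LL d 1≤L
    SS : ℕ
    SS = n ^ e
    n≤SS : n ≤ SS
    n≤SS = ≤-trans (≤-reflexive (sym (*-identityʳ n))) (pow-mono-exp n 1≤n 1≤e)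
    1≤SS : 1 ≤ SS
    1≤SS = ≤-trans 1≤n n≤SS
    FF : ℕ
    FF = 7 + (e + e)

    tapeLength-bound : ∀ s → s ≤ SS → ∀ m → m ≤ (n + suc s) * (8 * suc s + 8) → m ≤ n ^ FF
    tapeLength-bound s hs m hm = ≤-trans hm (≤-trans st1 (≤-trans (≤-reflexive (e1 SS)) (≤-trans st2 (≤-reflexive (sym eqF)))))
      where
      st1 : (n + suc s) * (8 * suc s + 8) ≤ (SS + (SS + SS)) * (8 * (SS + SS) + 8 * SS)
      st1 = *-mono-≤ (+-mono-≤ n≤SS (≤-trans (s≤s hs) (+-monoˡ-≤ SS 1≤SS)))
                     (+-mono-≤ (*-monoʳ-≤ 8 (≤-trans (s≤s hs) (+-monoˡ-≤ SS 1≤SS)))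
                               (≤-trans (≤-reflexive (sym (*-identityʳ 8))) (*-monoʳ-≤ 8 1≤SS)))
      e1 : ∀ SS → (SS + (SS + SS)) * (8 * (SS + SS) + 8 * SS) ≡ 72 * (SS * SS)
      e1 = solve 1 (λ SS → (SS :+ (SS :+ SS)) :* (con 8 :* (SS :+ SS) :+ con 8 :* SS) := con 72 :* (SS :* SS)) refl
      st2 : 72 * (SS * SS) ≤ n ^ 7 * (SS * SS)
      st2 = *-monoˡ-≤ (SS * SS) (≤-trans (≤ᵇ⇒≤ 72 (2 ^ 7) _) (^-monoˡ-≤ 7 n≥2))
      eqF : n ^ FF ≡ n ^ 7 * (SS * SS)
      eqF = trans (^-distribˡ-+-* n 7 (e + e)) (cong (n ^ 7 *_) (^-distribˡ-+-* n e e))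

    A : ℕ
    A = FF * (LL * FF)

    -- Hence m^{log m} ≤ n^A, as log m ≤ L · F.
    quasiPoly-bound : ∀ m → m ≤ n ^ FF → quasiPoly 1 m ≤ n ^ A
    quasiPoly-bound m hm = ≤-trans (^-monoˡ-≤ (⌈log₂ m ⌉ ^ 1) hm)
                     (≤-trans (pow-mono-exp (n ^ FF) (pow-pos n FF 1≤n) lg)
                       (≤-reflexive (^-*-assoc n FF (LL * FF))))
      where
      lg : ⌈log₂ m ⌉ ^ 1 ≤ LL * FF
      lg = ≤-trans (≤-reflexive (*-identityʳ ⌈log₂ m ⌉))
             (≤-trans (⌈log₂⌉-mono-≤ (≤-trans hm (≤-trans (^-monoˡ-≤ FF n≤) (≤-reflexive (^-*-assoc 2 LL FF)))))
                (≤-reflexive (⌈log₂2^n⌉≡n (LL * FF))))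

    -- The additive 2 is absorbed by one more factor n.
    1≤A : 1 ≤ A
    1≤A = *-mono-≤ {1} {FF} {1} {LL * FF} (s≤s z≤n) (*-mono-≤ {1} {LL} {1} {FF} 1≤L (s≤s z≤n))

    absorb-2 : n ^ A + 2 ≤ n ^ suc A
    absorb-2 = ≤-trans (+-monoʳ-≤ (n ^ A) 2≤) (≤-trans (≤-reflexive (cong (n ^ A +_) (sym (+-identityʳ (n ^ A))))) (*-monoˡ-≤ (n ^ A) n≥2))
      where
      2≤ : 2 ≤ n ^ A
      2≤ = ≤-trans n≥2 (≤-trans (≤-reflexive (sym (*-identityʳ n))) (pow-mono-exp n 1≤n 1≤A))

    -- The exponent: A + 1 ≤ 81 L^{2d+1} + 1 ≤ 82 L^{2d+1} ≤ L^{2d+2}.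
    exponent-bound : suc A ≤ LL ^ (2 * suc d)
    exponent-bound = ≤-trans (s≤s stA) (≤-trans st82 (≤-trans (*-monoˡ-≤ (LL ^ suc (d + d)) L≥82) (≤-reflexive (sym eqK))))
      where
      F≤ : FF ≤ 9 * e
      F≤ = ≤-trans (+-monoˡ-≤ (e + e) (≤-trans (≤-reflexive (sym (*-identityʳ 7))) (*-monoʳ-≤ 7 1≤e))) (≤-reflexive (e9 e))
        where
        e9 : ∀ e → 7 * e + (e + e) ≡ 9 * e
        e9 = solve 1 (λ e → con 7 :* e :+ (e :+ e) := con 9 :* e) refl
      eqE : e * e ≡ LL ^ (d + d)
      eqE = sym (^-distribˡ-+-* LL d d)
      stA : A ≤ 81 * LL ^ suc (d + d)
      stA = ≤-trans (*-mono-≤ F≤ (*-monoʳ-≤ LL F≤)) (≤-reflexive (trans (e81 e LL) (cong (λ z → 81 * (LL * z)) eqE)))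
        where
        e81 : ∀ e L → 9 * e * (L * (9 * e)) ≡ 81 * (L * (e * e))
        e81 = solve 2 (λ e L → con 9 :* e :* (L :* (con 9 :* e)) := con 81 :* (L :* (e :* e))) refl
      st82 : suc (81 * LL ^ suc (d + d)) ≤ 82 * LL ^ suc (d + d)
      st82 = ≤-trans (+-monoˡ-≤ (81 * LL ^ suc (d + d)) (pow-pos LL (suc (d + d)) 1≤L)) (≤-reflexive (e82 (LL ^ suc (d + d))))
        where
        e82 : ∀ x → x + 81 * x ≡ 82 * x
        e82 = solve 1 (λ x → x :+ con 81 :* x := con 82 :* x) refl
      eqK : LL ^ (2 * suc d) ≡ LL * LL ^ suc (d + d)
      eqK = cong (LL ^_) (ek d)
        where
        ek : ∀ d → 2 * suc d ≡ suc (suc (d + d))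
        ek = solve 1 (λ d → con 2 :* (con 1 :+ d) := con 2 :+ (d :+ d)) refl

    padded : ∀ s → s ≤ SS → ∀ m → m ≤ (n + suc s) * (8 * suc s + 8) → quasiPoly 1 m + 2 ≤ n ^ (LL ^ (2 * suc d))
    padded s hs m hm = ≤-trans (+-monoˡ-≤ 2 (quasiPoly-bound m (tapeLength-bound s hs m hm)))
                        (≤-trans absorb-2 (pow-mono-exp n 1≤n exponent-bound))

  paddedSize-bound : ∀ d → Eventually λ n → ∀ s → s ≤ quasiPoly d n → ∀ m → m ≤ (n + suc s) * (8 * suc s + 8) →
    quasiPoly 1 m + 2 ≤ quasiPoly (2 * suc d) n
  paddedSize-bound d = 2 ^ 82 , λ n hn → Core.padded n ⌈log₂ n ⌉ d (≤-trans (2≤2^ 81) hn)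
    (logLB 82 n hn) (n≤2^⌈log₂n⌉ n)
    where
    2≤2^ : ∀ k → 2 ≤ 2 ^ suc k
    2≤2^ k = *-monoʳ-≤ 2 (1≤2^ k)
    logLB : ∀ k n → 2 ^ k ≤ n → k ≤ ⌈log₂ n ⌉
    logLB k n h = ≤-trans (≤-reflexive (sym (⌈log₂2^n⌉≡n k))) (⌈log₂⌉-mono-≤ h)

  quasiPoly-mono : ∀ d → Eventually λ n → quasiPoly d n ≤ quasiPoly (2 * suc d) n
  quasiPoly-mono d = 2 , λ n hn → pow-mono-exp n (≤-trans (s≤s z≤n) hn) (pow-mono-exp ⌈log₂ n ⌉ (log-pos n hn) (dle d))
    where
    dle : ∀ d → d ≤ 2 * suc d
    dle d = ≤-trans (n≤1+n d) (m≤m+n (suc d) (suc d + 0))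

module Transfer where

  open import Data.Bool using (Bool)
  open import Data.Nat using (ℕ; suc; _+_; _*_; _≤_; _⊔_)
  open import Data.Nat.Properties
  open import Data.Nat.Logarithm using (⌈log₂_⌉; ⌈log₂⌉-mono-≤)
  open import Data.List using (map; length)
  open import Data.Vec using (Vec; toList; fromList)
  open import Data.Vec.Properties using (toList-map; toList∘fromList)
  open import Data.Product using (Σ; _×_; _,_; proj₁; proj₂)
  open import Relation.Binary.PropositionalEquality
  open Machine using (CVP)
  open Evaluation using (CVP-correct; tape; pending)
  open Projection
  open Padding using (tapeTemplate; tapeTemplate-correct; length-tapeTemplate)
  open Bounds using (paddedSize-bound; quasiPoly-mono)

  reduce : ∀ {P : ∀ {w} → Gate w → Set} → Closed P →
    ∀ {n} (c : Circuit n) → AllGates FanIn2 c → (g : Vec Bool n → Bool) → Computes c g →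
    (cm : Circuit (length (tapeTemplate c))) → AllGates P cm → Computes cm (CVP (length (tapeTemplate c))) →
    Σ (Circuit n) λ c' → AllGates P c' × size c' ≡ 2 + size cm × depth c' ≤ depth cm + 2 × Computes c' g
  reduce cl c hc g comp cm hP compm =
    restrict ρ cm , restrict-gates cl ρ cm hP , restrict-size ρ cm , restrict-depth ρ cm , computes
    where
    ρ : Vec _ (length (tapeTemplate c))
    ρ = fromList (tapeTemplate c)
    tapeOf : ∀ x → toList (Data.Vec.map (resolve x) ρ) ≡ tape x 0 (pending c)
    tapeOf x = trans (toList-map (resolve x) ρ) (trans (cong (map (resolve x)) (toList∘fromList (tapeTemplate c))) (tapeTemplate-correct x c))
    computes : Computes (restrict ρ cm) g
    computes x = trans (restrict-eval ρ cm x) (trans (compm _) (trans (CVP-correct _ _ c hc x (tapeOf x)) (comp x)))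

  n≤length-tapeTemplate : ∀ {n} (c : Circuit n) → n ≤ length (tapeTemplate c)
  n≤length-tapeTemplate {n} c = ≤-trans (m≤m+n n (suc (size c)))
    (≤-trans (m≤m*n (n + suc (size c)) (8 * suc (size c) + 8)) (≤-reflexive (sym (length-tapeTemplate c))))

  transfer : ∀ {P : ∀ {w} → Gate w → Set} → Closed P → (D : ℕ → ℕ) → SizeDepth P (quasiPoly 1) D CVP →
    ∀ d (D' : ℕ → ℕ) → (∀ m n → quasiPoly 1 m + 2 ≤ quasiPoly (2 * suc d) n → D m + 2 ≤ D' n) →
    ∀ f → InSIZE (quasiPoly d) f → SizeDepth P (quasiPoly (2 * suc d)) D' f
  transfer {P} cl D (m₀ , cvp) d D' dominates f (n₀ , small) = n₀ ⊔ m₀ ⊔ b₀ , go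
    where
    b₀ : ℕ
    b₀ = proj₁ (paddedSize-bound d)
    go : ∀ n → n₀ ⊔ m₀ ⊔ b₀ ≤ n →
      Σ (Circuit n) λ c' → AllGates P c' × size c' ≤ quasiPoly (2 * suc d) n × depth c' ≤ D' n × Computes c' (f n)
    go n hn with small n (m⊔n≤o⇒m≤o n₀ m₀ (m⊔n≤o⇒m≤o (n₀ ⊔ m₀) b₀ hn))
    ... | c , hc , sz , comp
      with cvp (length (tapeTemplate c)) (≤-trans (m⊔n≤o⇒n≤o n₀ m₀ (m⊔n≤o⇒m≤o (n₀ ⊔ m₀) b₀ hn)) (n≤length-tapeTemplate c))
    ... | cm , hP , szm , dpm , compm with reduce cl c hc (f n) comp cm hP compm
    ... | c' , hP' , sz' , dp' , comp' =
      c' , hP' , ≤-trans (≤-reflexive sz') (≤-trans (≤-reflexive (+-comm 2 (size cm))) (≤-trans (+-monoˡ-≤ 2 szm) padded)) ,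
      ≤-trans dp' (≤-trans (+-monoˡ-≤ 2 dpm) (dominates (length (tapeTemplate c)) n padded)) , comp'
      where
      padded : quasiPoly 1 (length (tapeTemplate c)) + 2 ≤ quasiPoly (2 * suc d) n
      padded = proj₂ (paddedSize-bound d) n (m⊔n≤o⇒n≤o (n₀ ⊔ m₀) b₀ hn) (size c) sz
        (length (tapeTemplate c)) (≤-reflexive (length-tapeTemplate c))

  -- Raising a size bound: for P/poly the transfer is only monotonicity.
  InSIZE-mono : ∀ d f → InSIZE (quasiPoly d) f → InSIZE (quasiPoly (2 * suc d)) f
  InSIZE-mono d f (n₀ , small) = n₀ ⊔ b₀ , go
    where
    b₀ : ℕ
    b₀ = proj₁ (quasiPoly-mono d)
    go : ∀ n → n₀ ⊔ b₀ ≤ n →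
      Σ (Circuit n) λ c → AllGates FanIn2 c × size c ≤ quasiPoly (2 * suc d) n × Computes c (f n)
    go n hn with small n (m⊔n≤o⇒m≤o n₀ b₀ hn)
    ... | c , hc , sz , comp = c , hc , ≤-trans sz (proj₂ (quasiPoly-mono d) n (m⊔n≤o⇒n≤o n₀ b₀ hn)) , comp

  nc1-depth : ∀ k d m n → quasiPoly 1 m + 2 ≤ quasiPoly (2 * suc d) n →
    k * ⌈log₂ (quasiPoly 1 m) ⌉ + k + 2 ≤ (k + 2) * ⌈log₂ (quasiPoly (2 * suc d) n) ⌉ + (k + 2)
  nc1-depth k d m n q = ≤-trans (≤-reflexive (+-assoc (k * ⌈log₂ (quasiPoly 1 m) ⌉) k 2))
    (+-monoˡ-≤ (k + 2) (*-mono-≤ (m≤m+n k 2) (⌈log₂⌉-mono-≤ (≤-trans (m≤m+n (quasiPoly 1 m) 2) q))))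

  classTransfer : ∀ C → InClass C (quasiPoly 1) CVP →
    ∀ d f → InSIZE (quasiPoly d) f → InClass C (quasiPoly (2 * suc d)) f
  classTransfer AC0 (D , cvp) d f hf =
    D + 2 , transfer closedAC (λ _ → D) cvp d (λ _ → D + 2) (λ _ _ _ → ≤-refl) f hf
  classTransfer ACC (m , 2≤m , D , cvp) d f hf =
    m , 2≤m , D + 2 , transfer (closedACC m) (λ _ → D) cvp d (λ _ → D + 2) (λ _ _ _ → ≤-refl) f hf
  classTransfer TC0 (D , cvp) d f hf =
    D + 2 , transfer closedTC (λ _ → D) cvp d (λ _ → D + 2) (λ _ _ _ → ≤-refl) f hf
  classTransfer NC1 (k , cvp) d f hf =
    k + 2 , transfer closedFanIn2 (λ m → k * ⌈log₂ (quasiPoly 1 m) ⌉ + k) cvp d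
      (λ n → (k + 2) * ⌈log₂ (quasiPoly (2 * suc d) n) ⌉ + (k + 2)) (nc1-depth k d) f hf
  classTransfer PPoly _ = InSIZE-mono

open Transfer using (classTransfer)
open Machine using (CVP; CVP∈P)

lemma6 : (C : TypicalClass) →
    ((L : BoolFamily) → InP L → InClass C (quasiPoly 1) L) →
    ∃[ k ] ((d : ℕ) (f : BoolFamily) →
    InSIZE (quasiPoly d) f → InClass C (quasiPoly (k * suc d)) f)
lemma6 C hyp = 2 , classTransfer C (hyp CVP CVP∈P)
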